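{- Suppose the positive integer $m$ is of one of the following forms: (i) $m=p^\alpha$ with $p$ prime; (ii) $m=p^\alpha q^\beta$ with $p,q$ distinct primes; (iii) $m=2^\alpha p^\beta q^\gamma$ with $p,q$ distinct odd primes. Then the cyclotomic polytope $\mathcal{C}_m$ is totally unimodular.
   Context: A matrix with entries in $\{0,+1,-1\}$ is totally unimodular if every square submatrix has determinant $0$, $+1$ or $-1$; a lattice polytope is totally unimodular if the matrix whose columns are the lattice points of the polytope is totally unimodular. Cyclotomic polytopes: for $p$ prime, $\mathcal{C}_p=\operatorname{conv}(e_1,\dots,e_{p-1},-\sum_ie_i)\subset\mathbb{R}^{p-1}$; for $p$ prime and $\alpha\ge2$, with $\zeta=e^{2\pi i/p^\alpha}$, identify the $\mathbb{Z}$-basis element $\zeta^{k+jp^{\alpha-1}}$ ($0\le k\le p^{\alpha-1}-1$, $0\le j\le p-2$) with $e_{k(p-1)+j}\in\mathbb{R}^{\phi(p^\alpha)}$ and let $\mathcal{C}_{p^\alpha}$ be the convex hull of the points representing all powers of $\zeta$; for $m=m_1m_2$ with $m_1,m_2>1$ coprime, $\mathcal{C}_m=\mathcal{C}_{m_1}\otimes\mathcal{C}_{m_2}\subset\mathbb{R}^{\phi(m_1)}\otimes\mathbb{R}^{\phi(m_2)}$, where $P\otimes Q=\operatorname{conv}(v_i\otimes w_j)$ over vertices $v_i$ of $P$, $w_j$ of $Q$. -}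

module Defs where

open import Data.Nat as ℕ using (ℕ; zero; suc; _∸_; _^_)
open import Data.Integer as ℤ using (ℤ; +_; -_)
open import Data.Rational as ℚ using (ℚ; 0ℚ; 1ℚ; _≤_)
open import Data.Fin as Fin using (Fin; zero; suc; toℕ; remQuot; punchIn)
open import Data.Fin.Properties using () renaming (_≟_ to _≟ᶠ_)
open import Data.Nat.Properties using () renaming (_≟_ to _≟ⁿ_)
open import Data.Product using (Σ; Σ-syntax; _×_; _,_; proj₁; proj₂)
open import Data.Sum using (_⊎_)
open import Relation.Binary.PropositionalEquality using (_≡_)
open import Relation.Nullary using (yes; no)

-- A finite point configuration in ℤ^dim: `size` points, point x has
-- coordinates pt x : Fin dim → ℤ.  It stands for the lattice polytope
-- conv(pt 0, …, pt (size-1)) ⊂ ℝ^dim.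
record PointConfig : Set where
  field
    dim  : ℕ
    size : ℕ
    pt   : Fin size → Fin dim → ℤ
open PointConfig public

sumℚ : ∀ {n} → (Fin n → ℚ) → ℚ
sumℚ {zero}  f = 0ℚ
sumℚ {suc n} f = f zero ℚ.+ sumℚ (λ i → f (suc i))

sumℤ : ∀ {n} → (Fin n → ℤ) → ℤ
sumℤ {zero}  f = + 0
sumℤ {suc n} f = f zero ℤ.+ sumℤ (λ i → f (suc i))

toℚ : ℤ → ℚ
toℚ z = z ℚ./ 1

-- z ∈ ℤ^dim is a lattice point of conv(P): z is a convex combination
-- (with rational, equivalently real, coefficients) of the points of P.
IsLatticePoint : (P : PointConfig) → (Fin (dim P) → ℤ) → Set
IsLatticePoint P z =
  Σ[ λ' ∈ (Fin (size P) → ℚ) ]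
    ((∀ x → 0ℚ ≤ λ' x)
    × sumℚ λ' ≡ 1ℚ
    × (∀ i → sumℚ (λ x → λ' x ℚ.* toℚ (pt P x i)) ≡ toℚ (z i)))

sign : ℕ → ℤ
sign zero          = + 1
sign (suc zero)    = - (+ 1)
sign (suc (suc n)) = sign n

det : ∀ k → (Fin k → Fin k → ℤ) → ℤ
det zero    M = + 1
det (suc k) M =
  sumℤ (λ j → sign (toℕ j) ℤ.* M zero j
              ℤ.* det k (λ i j' → M (suc i) (punchIn j j')))

-- Total unimodularity of the lattice polytope conv(P): every square
-- submatrix of the matrix whose columns are the lattice points of conv(P)
-- has determinant 0, 1 or -1.  A k×k submatrix is given by a choice of k
-- rows r and k lattice points (columns) c; allowing repeated rows/columns
-- only adds matrices with determinant 0, so this is equivalent.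
-- (The 1×1 case forces all entries to lie in {0,±1}.)
TotallyUnimodular : PointConfig → Set
TotallyUnimodular P =
  ∀ (k : ℕ) (r : Fin k → Fin (dim P)) (c : Fin k → Fin (dim P) → ℤ) →
  (∀ j → IsLatticePoint P (c j)) →
  let d = det k (λ i j → c j (r i)) in
  d ≡ + 0 ⊎ d ≡ + 1 ⊎ d ≡ - (+ 1)

-- Cyclotomic polytope C_{p^α} with α = suc a, ζ = e^{2πi/p^α}.
-- Coordinates: Fin (p^a * (p-1)); index k*(p-1)+j (k < p^a, j ≤ p-2)
-- is the basis element ζ^(k + j p^a).
-- Points: all powers ζ^n, n < p^α = p * p^a, with n = j*p^a + k
-- (j < p, k < p^a).  For j ≤ p-2 this is the basis vector e_{k(p-1)+j};
-- for j = p-1 it is -Σ_{j'≤p-2} e_{k(p-1)+j'}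
-- (since 1 + ω + … + ω^(p-1) = 0 for ω = ζ^(p^a)).
-- For a = 0 this is exactly C_p = conv(e_1,…,e_{p-1}, -Σ e_i).
cycPt : (p a : ℕ) → Fin (p ^ suc a) → Fin (p ^ a ℕ.* (p ∸ 1)) → ℤ
cycPt p a n i with remQuot {p} (p ^ a) n | remQuot {p ^ a} (p ∸ 1) i
... | (j , k) | (k' , j') with k ≟ᶠ k'
...   | no  _ = + 0
...   | yes _ with toℕ j ≟ⁿ (p ∸ 1)
...     | yes _ = - (+ 1)
...     | no  _ with toℕ j ≟ⁿ toℕ j'
...       | yes _ = + 1
...       | no  _ = + 0

Cyc : (p a : ℕ) → PointConfig
Cyc p a = record { dim = p ^ a ℕ.* (p ∸ 1) ; size = p ^ suc a ; pt = cycPt p a }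

-- Tensor product P ⊗ Q = conv(v ⊗ w), ℝ^d₁ ⊗ ℝ^d₂ ≅ ℝ^(d₁ d₂) with
-- e_r ⊗ e_s ↦ e_{r d₂ + s}.
_⊗_ : PointConfig → PointConfig → PointConfig
P ⊗ Q = record
  { dim  = dim P ℕ.* dim Q
  ; size = size P ℕ.* size Q
  ; pt   = λ x i →
      let (a , b) = remQuot (size Q) x
          (r , s) = remQuot (dim Q) i
      in pt P a r ℤ.* pt Q b s
  }

-- Identify the coordinates of C_{p^α} ⊗ C_{q^β} with the cells (block, row, column) of a disjoint
-- union of grids: blocks are the pairs (k, k′), rows and columns the indices j, j′. Every vertex is
-- then ± the indicator vector of a box in one block: a single cell, a row, a column or the whole
-- block (the last three come from 1 + ω + ⋯ + ω^(p-1) = 0). For C_{p^α} the grids have one column,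
-- and tensoring with the cross-polytope C_{2^α} only multiplies the blocks. A lattice point of the convex hull of all signed boxes is 0 or a signed
-- box, since it satisfies a few integral inequalities valid on all of them, such as
-- z_x + z_y + z_w − z_u ≤ 2 whenever every box through x, y, w contains u. A square matrix whose
-- columns are signed boxes has determinant 0 or ±1: repeated rows or boxes give 0, a single-cell
-- column can be expanded, and otherwise subtracting from each block column the row columns of its
-- block leaves at most one nonzero entry per row among row and block columns and one among column
-- columns, which is handled like the incidence matrix of a bipartite graph.

module Submission where

open import Defs
open import Data.Nat using (ℕ)
open import Data.Nat.Primality using (Prime)
open import Data.Product using (_×_)
open import Relation.Binary.PropositionalEquality using (_≢_)

import Algebra.Properties.CommutativeSemigroup as CommutativeSemigroupProperties
import Algebra.Properties.Semiring.Sum as SemiringSum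
import Data.Bool.Properties as Boolₚ
import Data.Fin.Properties as Finₚ
import Data.Integer.Properties as ℤₚ
import Data.Nat.Properties as ℕₚ
import Data.Rational.Properties as ℚₚ
import Data.Rational.Unnormalised.Properties as ℚᵘₚ
import Data.Unit.Properties as ⊤ₚ
open import Algebra.Bundles using (CommutativeMonoid; Ring)
open import Data.Bool as Bool using (Bool; true; false; if_then_else_; _∧_)
open import Data.Empty using (⊥; ⊥-elim)
open import Data.Fin as Fin using (Fin; zero; suc; toℕ; punchIn; punchOut; inject₁; remQuot)
open import Data.Fin.Properties using (_≟_; punchInᵢ≢i; punchIn-punchOut; punchIn-injective; any?; all?; ¬∀⟶∃¬)
open import Data.Integer as ℤ using (ℤ; +_; -_; _+_; _*_; _◃_; 0ℤ; 1ℤ; -1ℤ)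
open import Data.Integer.Tactic.RingSolver using (solve-∀)
open import Data.Nat as ℕ using (zero; suc)
open import Data.Product using (∃; ∃₂; _,_; proj₁; proj₂)
open import Data.Product.Properties using (≡-dec)
open import Data.Rational as ℚ using (ℚ; 1ℚ; toℚᵘ)
open import Data.Rational.Unnormalised using (mkℚᵘ; *≡*; *≤*) renaming (_≃_ to _≃ᵘ_)
open import Data.Sign as Sign using (Sign)
open import Data.Sum as Sum using (_⊎_; inj₁; inj₂; [_,_]′)
open import Data.Unit using (⊤; tt)
open import Data.Vec.Functional using (updateAt; _∷_; [])
open import Data.Vec.Functional.Properties using (updateAt-updates; updateAt-minimal; updateAt-id-local)
open import Function using (_∘_)
open import Relation.Binary using (tri<; tri≈; tri>)
open import Relation.Binary.Definitions using (DecidableEquality)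
open import Relation.Binary.PropositionalEquality
open import Relation.Nullary using (¬_; Dec; yes; no; does)
open import Relation.Nullary.Decidable
  using (dec-true; dec-false; decidable-stable; ¬?; _×-dec_; map′; True; toWitness)

module ∑ℤ = SemiringSum ℤₚ.+-*-semiring

sumℤ≡∑ : ∀ {n} (f : Fin n → ℤ) → sumℤ f ≡ ∑ℤ.sum f
sumℤ≡∑ {zero}  f = refl
sumℤ≡∑ {suc n} f = cong (_+_ (f zero)) (sumℤ≡∑ (f ∘ suc))

sumℤ-cong : ∀ {n} {f g : Fin n → ℤ} → (∀ i → f i ≡ g i) → sumℤ f ≡ sumℤ g
sumℤ-cong {zero}  f≗g = refl
sumℤ-cong {suc n} f≗g = cong₂ _+_ (f≗g zero) (sumℤ-cong (f≗g ∘ suc))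

sumℤ-zero : ∀ {n} {f : Fin n → ℤ} → (∀ i → f i ≡ 0ℤ) → sumℤ f ≡ 0ℤ
sumℤ-zero {zero}  f≗0 = refl
sumℤ-zero {suc n} f≗0 = cong₂ _+_ (f≗0 zero) (sumℤ-zero (f≗0 ∘ suc))

sumℤ-distrib-+ : ∀ {n} (f g : Fin n → ℤ) → sumℤ (λ i → f i + g i) ≡ sumℤ f + sumℤ g
sumℤ-distrib-+ f g = begin
  sumℤ (λ i → f i + g i)    ≡⟨ sumℤ≡∑ (λ i → f i + g i) ⟩
  ∑ℤ.sum (λ i → f i + g i)  ≡⟨ ∑ℤ.∑-distrib-+ f g ⟩
  ∑ℤ.sum f + ∑ℤ.sum g       ≡⟨ cong₂ _+_ (sumℤ≡∑ f) (sumℤ≡∑ g) ⟨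
  sumℤ f + sumℤ g           ∎
  where open ≡-Reasoning

sumℤ-*ˡ : ∀ {n} a (f : Fin n → ℤ) → sumℤ (λ i → a * f i) ≡ a * sumℤ f
sumℤ-*ˡ a f = begin
  sumℤ (λ i → a * f i)    ≡⟨ sumℤ≡∑ (λ i → a * f i) ⟩
  ∑ℤ.sum (λ i → a * f i)  ≡⟨ ∑ℤ.*-distribˡ-sum a f ⟨
  a * ∑ℤ.sum f            ≡⟨ cong (a *_) (sumℤ≡∑ f) ⟨
  a * sumℤ f              ∎
  where open ≡-Reasoning

sumℤ-comm : ∀ {m n} (f : Fin m → Fin n → ℤ) →
            sumℤ (λ i → sumℤ (f i)) ≡ sumℤ (λ j → sumℤ (λ i → f i j))
sumℤ-comm f = begin
  sumℤ (λ i → sumℤ (f i))                  ≡⟨ sumℤ-cong (λ i → sumℤ≡∑ (f i)) ⟩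
  sumℤ (λ i → ∑ℤ.sum (f i))                ≡⟨ sumℤ≡∑ (λ i → ∑ℤ.sum (f i)) ⟩
  ∑ℤ.sum (λ i → ∑ℤ.sum (f i))              ≡⟨ ∑ℤ.∑-comm f ⟩
  ∑ℤ.sum (λ j → ∑ℤ.sum (λ i → f i j))      ≡⟨ sumℤ≡∑ (λ j → ∑ℤ.sum (λ i → f i j)) ⟨
  sumℤ (λ j → ∑ℤ.sum (λ i → f i j))        ≡⟨ sumℤ-cong (λ j → sumℤ≡∑ (λ i → f i j)) ⟨
  sumℤ (λ j → sumℤ (λ i → f i j))          ∎
  where open ≡-Reasoning

sumℤ-remove : ∀ {n} (j : Fin (suc n)) (f : Fin (suc n) → ℤ) →
              sumℤ f ≡ f j + sumℤ (f ∘ punchIn j)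
sumℤ-remove j f = begin
  sumℤ f                       ≡⟨ sumℤ≡∑ f ⟩
  ∑ℤ.sum f                     ≡⟨ ∑ℤ.sum-remove f ⟩
  f j + ∑ℤ.sum (f ∘ punchIn j) ≡⟨ cong (_+_ (f j)) (sumℤ≡∑ (f ∘ punchIn j)) ⟨
  f j + sumℤ (f ∘ punchIn j)   ∎
  where open ≡-Reasoning

sumℤ-single : ∀ {n} (j : Fin n) (f : Fin n → ℤ) →
              (∀ i → i ≢ j → f i ≡ 0ℤ) → sumℤ f ≡ f j
sumℤ-single {suc n} j f others = begin
  sumℤ f                      ≡⟨ sumℤ-remove j f ⟩
  f j + sumℤ (f ∘ punchIn j)  ≡⟨ cong (_+_ (f j)) (sumℤ-zero (λ i → others _ (punchInᵢ≢i j i))) ⟩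
  f j + 0ℤ                    ≡⟨ ℤₚ.+-identityʳ (f j) ⟩
  f j                         ∎
  where open ≡-Reasoning

sumℤ-pair : ∀ {n} {a b : Fin n} (f : Fin n → ℤ) → a ≢ b →
            (∀ i → i ≢ a → i ≢ b → f i ≡ 0ℤ) → sumℤ f ≡ f a + f b
sumℤ-pair {suc n} {a} {b} f a≢b others = begin
  sumℤ f                                       ≡⟨ sumℤ-remove a f ⟩
  f a + sumℤ (f ∘ punchIn a)                   ≡⟨ cong (_+_ (f a)) (sumℤ-single (punchOut a≢b) _ others′) ⟩
  f a + f (punchIn a (punchOut a≢b))           ≡⟨ cong (λ i → f a + f i) (punchIn-punchOut a≢b) ⟩
  f a + f b                                    ∎
  where
  open ≡-Reasoning
  others′ : ∀ i → i ≢ punchOut a≢b → f (punchIn a i) ≡ 0ℤ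
  others′ i i≢ = others _ (punchInᵢ≢i a i)
    (λ eq → i≢ (punchIn-injective a i _ (trans eq (sym (punchIn-punchOut a≢b)))))

-- Determinants

IsUnit : ℤ → Set
IsUnit x = x ≡ 1ℤ ⊎ x ≡ -1ℤ

ZeroOrUnit : ℤ → Set
ZeroOrUnit x = x ≡ 0ℤ ⊎ IsUnit x

IsUnit-* : ∀ {a b} → IsUnit a → IsUnit b → IsUnit (a * b)
IsUnit-* (inj₁ refl) (inj₁ refl) = inj₁ refl
IsUnit-* (inj₁ refl) (inj₂ refl) = inj₂ refl
IsUnit-* (inj₂ refl) (inj₁ refl) = inj₂ refl
IsUnit-* (inj₂ refl) (inj₂ refl) = inj₁ refl

IsUnit-square : ∀ {a} → IsUnit a → a * a ≡ 1ℤ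
IsUnit-square (inj₁ refl) = refl
IsUnit-square (inj₂ refl) = refl

IsUnit-neg : ∀ {a} → IsUnit a → IsUnit (- a)
IsUnit-neg (inj₁ refl) = inj₂ refl
IsUnit-neg (inj₂ refl) = inj₁ refl

ZeroOrUnit-* : ∀ {a b} → ZeroOrUnit a → ZeroOrUnit b → ZeroOrUnit (a * b)
ZeroOrUnit-* (inj₁ refl)      _           = inj₁ refl
ZeroOrUnit-* {a} (inj₂ _)     (inj₁ refl) = inj₁ (ℤₚ.*-zeroʳ a)
ZeroOrUnit-* (inj₂ a-unit)    (inj₂ b-unit) = inj₂ (IsUnit-* a-unit b-unit)

IsUnit-*-cancel : ∀ {u x} → IsUnit u → u * x ≡ 0ℤ → x ≡ 0ℤ
IsUnit-*-cancel {x = x} (inj₁ refl) ux≡0 = trans (sym (ℤₚ.*-identityˡ x)) ux≡0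
IsUnit-*-cancel {x = x} (inj₂ refl) ux≡0 =
  trans (sym (ℤₚ.neg-involutive x)) (cong -_ (trans (sym (ℤₚ.-1*i≡-i x)) ux≡0))

sign-suc : ∀ n → sign (suc n) ≡ - sign n
sign-suc zero    = refl
sign-suc (suc n) = sym (trans (cong -_ (sign-suc n)) (ℤₚ.neg-involutive (sign n)))

sign-+ : ∀ m n → sign (m ℕ.+ n) ≡ sign m * sign n
sign-+ zero    n = sym (ℤₚ.*-identityˡ (sign n))
sign-+ (suc m) n = begin
  sign (suc (m ℕ.+ n))   ≡⟨ sign-suc (m ℕ.+ n) ⟩
  - sign (m ℕ.+ n)       ≡⟨ cong -_ (sign-+ m n) ⟩
  - (sign m * sign n)    ≡⟨ ℤₚ.neg-distribˡ-* (sign m) (sign n) ⟩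
  - sign m * sign n      ≡⟨ cong (_* sign n) (sign-suc m) ⟨
  sign (suc m) * sign n  ∎
  where open ≡-Reasoning

sign-isUnit : ∀ n → IsUnit (sign n)
sign-isUnit zero          = inj₁ refl
sign-isUnit (suc zero)    = inj₂ refl
sign-isUnit (suc (suc n)) = sign-isUnit n

Matrix : ℕ → Set
Matrix k = Fin k → Fin k → ℤ

minor : ∀ {k} → Matrix (suc k) → Fin (suc k) → Fin (suc k) → Matrix k
minor M i j x y = M (punchIn i x) (punchIn j y)

laplaceTerm : ∀ {k} → Matrix (suc k) → Fin (suc k) → ℤ
laplaceTerm {k} M j = sign (toℕ j) * M zero j * det k (minor M zero j)

laplaceTerm-zero-entry : ∀ s {x} d → x ≡ 0ℤ → s * x * d ≡ 0ℤ
laplaceTerm-zero-entry s d refl = trans (cong (_* d) (ℤₚ.*-zeroʳ s)) (ℤₚ.*-zeroˡ d)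

laplaceTerm-zero-minor : ∀ s x {d} → d ≡ 0ℤ → s * x * d ≡ 0ℤ
laplaceTerm-zero-minor s x refl = ℤₚ.*-zeroʳ (s * x)

det-cong : ∀ {k} {M N : Matrix k} → (∀ i j → M i j ≡ N i j) → det k M ≡ det k N
det-cong {zero}  M≗N = refl
det-cong {suc k} M≗N = sumℤ-cong λ j →
  cong₂ (λ x d → sign (toℕ j) * x * d) (M≗N zero j) (det-cong (λ x y → M≗N (suc x) (punchIn j y)))

det-zero-column : ∀ {k} (M : Matrix k) j → (∀ i → M i j ≡ 0ℤ) → det k M ≡ 0ℤ
det-zero-column {suc k} M j column≡0 = sumℤ-zero term≡0
  where
  term≡0 : ∀ c → laplaceTerm M c ≡ 0ℤ
  term≡0 c with c ≟ j
  ... | yes refl = laplaceTerm-zero-entry (sign (toℕ c)) _ (column≡0 zero)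
  ... | no c≢j   = laplaceTerm-zero-minor (sign (toℕ c)) (M zero c)
    (det-zero-column (minor M zero c) (punchOut c≢j)
      (λ x → trans (cong (M (suc x)) (punchIn-punchOut c≢j)) (column≡0 (suc x))))

det-linear-column : ∀ {k} (M N P : Matrix k) j a b →
                    (∀ i c → c ≢ j → M i c ≡ N i c) → (∀ i c → c ≢ j → M i c ≡ P i c) →
                    (∀ i → M i j ≡ a * N i j + b * P i j) →
                    det k M ≡ a * det k N + b * det k P
det-linear-column {suc k} M N P j a b M≈N M≈P column-j = begin
  sumℤ (laplaceTerm M)
    ≡⟨ sumℤ-cong term ⟩
  sumℤ (λ c → a * laplaceTerm N c + b * laplaceTerm P c)
    ≡⟨ sumℤ-distrib-+ (λ c → a * laplaceTerm N c) (λ c → b * laplaceTerm P c) ⟩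
  sumℤ (λ c → a * laplaceTerm N c) + sumℤ (λ c → b * laplaceTerm P c)
    ≡⟨ cong₂ _+_ (sumℤ-*ˡ a (laplaceTerm N)) (sumℤ-*ˡ b (laplaceTerm P)) ⟩
  a * det (suc k) N + b * det (suc k) P
    ∎
  where
  open ≡-Reasoning
  term : ∀ c → laplaceTerm M c ≡ a * laplaceTerm N c + b * laplaceTerm P c
  term c with c ≟ j
  ... | yes refl = begin
    s * M zero c * Dᴹ
      ≡⟨ cong₂ (λ x d → s * x * d) (column-j zero) Dᴹ≡Dᴺ ⟩
    s * (a * N zero c + b * P zero c) * Dᴺ
      ≡⟨ distrib a b s (N zero c) (P zero c) Dᴺ ⟩
    a * (s * N zero c * Dᴺ) + b * (s * P zero c * Dᴺ)
      ≡⟨ cong (λ d → a * laplaceTerm N c + b * (s * P zero c * d)) Dᴺ≡Dᴾ ⟩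
    a * laplaceTerm N c + b * laplaceTerm P c
      ∎
    where
    s Dᴹ Dᴺ : ℤ
    s = sign (toℕ c)
    Dᴹ = det k (minor M zero c)
    Dᴺ = det k (minor N zero c)
    distrib : ∀ a b s n p d → s * (a * n + b * p) * d ≡ a * (s * n * d) + b * (s * p * d)
    distrib = solve-∀
    Dᴹ≡Dᴺ : Dᴹ ≡ Dᴺ
    Dᴹ≡Dᴺ = det-cong (λ x y → M≈N (suc x) (punchIn c y) (punchInᵢ≢i c y))
    Dᴺ≡Dᴾ : Dᴺ ≡ det k (minor P zero c)
    Dᴺ≡Dᴾ = det-cong (λ x y → trans (sym (M≈N (suc x) (punchIn c y) (punchInᵢ≢i c y)))
                                    (M≈P (suc x) (punchIn c y) (punchInᵢ≢i c y)))
  ... | no c≢j = begin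
    s * M zero c * det k (minor M zero c)
      ≡⟨ cong (s * M zero c *_) minor-linear ⟩
    s * M zero c * (a * Dᴺ + b * Dᴾ)
      ≡⟨ distrib a b s (M zero c) Dᴺ Dᴾ ⟩
    a * (s * M zero c * Dᴺ) + b * (s * M zero c * Dᴾ)
      ≡⟨ cong₂ (λ n p → a * (s * n * Dᴺ) + b * (s * p * Dᴾ)) (M≈N zero c c≢j) (M≈P zero c c≢j) ⟩
    a * laplaceTerm N c + b * laplaceTerm P c
      ∎
    where
    s Dᴺ Dᴾ : ℤ
    s = sign (toℕ c)
    Dᴺ = det k (minor N zero c)
    Dᴾ = det k (minor P zero c)
    distrib : ∀ a b s m dn dp → s * m * (a * dn + b * dp) ≡ a * (s * m * dn) + b * (s * m * dp)
    distrib = solve-∀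
    punchIn≢j : ∀ y → y ≢ punchOut c≢j → punchIn c y ≢ j
    punchIn≢j y y≢ eq = y≢ (punchIn-injective c y _ (trans eq (sym (punchIn-punchOut c≢j))))
    at-j : ∀ {Q : Matrix (suc k)} x → minor Q zero c x (punchOut c≢j) ≡ Q (suc x) j
    at-j {Q} x = cong (Q (suc x)) (punchIn-punchOut c≢j)
    minor-linear : det k (minor M zero c) ≡ a * Dᴺ + b * Dᴾ
    minor-linear = det-linear-column (minor M zero c) (minor N zero c) (minor P zero c) (punchOut c≢j) a b
      (λ x y y≢ → M≈N (suc x) (punchIn c y) (punchIn≢j y y≢))
      (λ x y y≢ → M≈P (suc x) (punchIn c y) (punchIn≢j y y≢))
      (λ x → trans (at-j {M} x)
                   (trans (column-j (suc x)) (sym (cong₂ (λ n p → a * n + b * p) (at-j {N} x) (at-j {P} x)))))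

replaceColumn : ∀ {k} → Matrix k → Fin k → (Fin k → ℤ) → Matrix k
replaceColumn M j u i = updateAt (M i) j (λ _ → u i)

replaceColumn-at : ∀ {k} (M : Matrix k) j u i → replaceColumn M j u i j ≡ u i
replaceColumn-at M j u i = updateAt-updates j (M i)

replaceColumn-other : ∀ {k} (M : Matrix k) {j} u i {c} → c ≢ j → replaceColumn M j u i c ≡ M i c
replaceColumn-other M {j} u i {c} c≢j = updateAt-minimal c j (M i) c≢j

replaceColumn-same : ∀ {k} (M : Matrix k) j i c → replaceColumn M j (λ x → M x j) i c ≡ M i c
replaceColumn-same M j i = updateAt-id-local j (M i) refl

det-replaceColumn-linear : ∀ {k} (M : Matrix k) j a b u v →
  det k (replaceColumn M j (λ i → a * u i + b * v i)) ≡
  a * det k (replaceColumn M j u) + b * det k (replaceColumn M j v)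
det-replaceColumn-linear {k} M j a b u v =
  det-linear-column (replaceColumn M j w) (replaceColumn M j u) (replaceColumn M j v) j a b
    (λ i c c≢j → trans (replaceColumn-other M w i c≢j) (sym (replaceColumn-other M u i c≢j)))
    (λ i c c≢j → trans (replaceColumn-other M w i c≢j) (sym (replaceColumn-other M v i c≢j)))
    (λ i → trans (replaceColumn-at M j w i)
                 (sym (cong₂ (λ x y → a * x + b * y) (replaceColumn-at M j u i) (replaceColumn-at M j v i))))
  where
  w : Fin k → ℤ
  w i = a * u i + b * v i

replaceColumn-cong : ∀ {k} (M : Matrix k) j {u v} → (∀ i → u i ≡ v i) →
                     ∀ i c → replaceColumn M j u i c ≡ replaceColumn M j v i c
replaceColumn-cong M j u≗v i c = cong (λ x → updateAt (M i) j (λ _ → x) c) (u≗v i)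

det-replaceColumn-+ : ∀ {k} (M : Matrix k) j u v →
  det k (replaceColumn M j (λ i → u i + v i)) ≡ det k (replaceColumn M j u) + det k (replaceColumn M j v)
det-replaceColumn-+ {k} M j u v = begin
  det k (replaceColumn M j (λ i → u i + v i))
    ≡⟨ det-cong (replaceColumn-cong M j (λ i → sym (cong₂ _+_ (ℤₚ.*-identityˡ (u i)) (ℤₚ.*-identityˡ (v i))))) ⟩
  det k (replaceColumn M j (λ i → 1ℤ * u i + 1ℤ * v i))
    ≡⟨ det-replaceColumn-linear M j 1ℤ 1ℤ u v ⟩
  1ℤ * det k (replaceColumn M j u) + 1ℤ * det k (replaceColumn M j v)
    ≡⟨ cong₂ _+_ (ℤₚ.*-identityˡ (det k (replaceColumn M j u))) (ℤₚ.*-identityˡ (det k (replaceColumn M j v))) ⟩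
  det k (replaceColumn M j u) + det k (replaceColumn M j v) ∎
  where open ≡-Reasoning

det-replaceColumn-* : ∀ {k} (M : Matrix k) j a u →
  det k (replaceColumn M j (λ i → a * u i)) ≡ a * det k (replaceColumn M j u)
det-replaceColumn-* {k} M j a u = begin
  det k (replaceColumn M j (λ i → a * u i))
    ≡⟨ det-cong (replaceColumn-cong M j (λ i → sym (ℤₚ.+-identityʳ (a * u i)))) ⟩
  det k (replaceColumn M j (λ i → a * u i + 0ℤ * u i))
    ≡⟨ det-replaceColumn-linear M j a 0ℤ u u ⟩
  a * det k (replaceColumn M j u) + 0ℤ * det k (replaceColumn M j u)
    ≡⟨ cong (_+_ (a * det k (replaceColumn M j u))) (ℤₚ.*-zeroˡ (det k (replaceColumn M j u))) ⟩
  a * det k (replaceColumn M j u) + 0ℤ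
    ≡⟨ ℤₚ.+-identityʳ (a * det k (replaceColumn M j u)) ⟩
  a * det k (replaceColumn M j u) ∎
  where open ≡-Reasoning

replaceColumns : ∀ {k} → Matrix k → Fin k → Fin k → (Fin k → ℤ) → (Fin k → ℤ) → Matrix k
replaceColumns M a b u v = replaceColumn (replaceColumn M b v) a u

replaceColumns-at₁ : ∀ {k} (M : Matrix k) {a b} u v i → replaceColumns M a b u v i a ≡ u i
replaceColumns-at₁ M {a} {b} u v = replaceColumn-at (replaceColumn M b v) a u

replaceColumns-at₂ : ∀ {k} (M : Matrix k) {a b} → a ≢ b → ∀ u v i → replaceColumns M a b u v i b ≡ v i
replaceColumns-at₂ M {a} {b} a≢b u v i =
  trans (replaceColumn-other (replaceColumn M b v) u i (a≢b ∘ sym)) (replaceColumn-at M b v i)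

replaceColumns-other : ∀ {k} (M : Matrix k) {a b} u v i {c} → c ≢ a → c ≢ b →
                       replaceColumns M a b u v i c ≡ M i c
replaceColumns-other M {a} {b} u v i c≢a c≢b =
  trans (replaceColumn-other (replaceColumn M b v) u i c≢a) (replaceColumn-other M v i c≢b)

replaceColumns-comm : ∀ {k} (M : Matrix k) {a b} → a ≢ b → ∀ u v i c →
                      replaceColumns M a b u v i c ≡ replaceColumns M b a v u i c
replaceColumns-comm M {a} {b} a≢b u v i c with c ≟ a | c ≟ b
... | yes refl | yes refl = ⊥-elim (a≢b refl)
... | yes refl | no _     = trans (replaceColumns-at₁ M u v i) (sym (replaceColumns-at₂ M (a≢b ∘ sym) v u i))
... | no _     | yes refl = trans (replaceColumns-at₂ M a≢b u v i) (sym (replaceColumns-at₁ M v u i))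
... | no c≢a   | no c≢b   = trans (replaceColumns-other M u v i c≢a c≢b) (sym (replaceColumns-other M v u i c≢b c≢a))

replaceColumns-same : ∀ {k} (M : Matrix k) {a b} u v → (∀ i → u i ≡ M i a) → (∀ i → v i ≡ M i b) →
                      ∀ i c → replaceColumns M a b u v i c ≡ M i c
replaceColumns-same M {a} {b} u v u≗a v≗b i c with c ≟ a | c ≟ b
... | yes refl | _        = trans (replaceColumns-at₁ M u v i) (u≗a i)
... | no c≢a   | yes refl = trans (replaceColumns-at₂ M (c≢a ∘ sym) u v i) (v≗b i)
... | no c≢a   | no c≢b   = replaceColumns-other M u v i c≢a c≢b

det-replaceColumns-bilinear : ∀ {k} (M : Matrix k) {a b} → a ≢ b → ∀ x y →
  det k (replaceColumns M a b (λ i → x i + y i) (λ i → x i + y i)) ≡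
  (det k (replaceColumns M a b x x) + det k (replaceColumns M a b x y)) +
  (det k (replaceColumns M a b y x) + det k (replaceColumns M a b y y))
det-replaceColumns-bilinear {k} M {a} {b} a≢b x y = begin
  det k (W x+y x+y)                      ≡⟨ det-replaceColumn-+ (replaceColumn M b x+y) a x y ⟩
  det k (W x x+y) + det k (W y x+y)      ≡⟨ cong₂ _+_ (linearʳ x) (linearʳ y) ⟩
  (det k (W x x) + det k (W x y)) + (det k (W y x) + det k (W y y)) ∎
  where
  open ≡-Reasoning
  W : (Fin k → ℤ) → (Fin k → ℤ) → Matrix k
  W = replaceColumns M a b
  x+y : Fin k → ℤ
  x+y i = x i + y i
  swapped : ∀ u v → det k (W u v) ≡ det k (replaceColumns M b a v u)
  swapped u v = det-cong (replaceColumns-comm M a≢b u v)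
  linearʳ : ∀ u → det k (W u x+y) ≡ det k (W u x) + det k (W u y)
  linearʳ u = begin
    det k (W u x+y)                                                   ≡⟨ swapped u x+y ⟩
    det k (replaceColumns M b a x+y u)                                ≡⟨ det-replaceColumn-+ (replaceColumn M a u) b x y ⟩
    det k (replaceColumns M b a x u) + det k (replaceColumns M b a y u) ≡⟨ cong₂ _+_ (swapped u x) (swapped u y) ⟨
    det k (W u x) + det k (W u y)                                     ∎

data Adjacent : ∀ {n} → Fin n → Fin n → Set where
  adjacent-zero : ∀ {n} → Adjacent {suc (suc n)} zero (suc zero)
  adjacent-suc  : ∀ {n} {a b : Fin n} → Adjacent a b → Adjacent (suc a) (suc b)

toℕ-Adjacent : ∀ {n} (a b : Fin n) → suc (toℕ a) ≡ toℕ b → Adjacent a b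
toℕ-Adjacent zero    (suc zero) refl = adjacent-zero
toℕ-Adjacent (suc a) (suc b)    eq   = adjacent-suc (toℕ-Adjacent a b (ℕₚ.suc-injective eq))

Adjacent-toℕ : ∀ {n} {a b : Fin n} → Adjacent a b → toℕ b ≡ suc (toℕ a)
Adjacent-toℕ adjacent-zero    = refl
Adjacent-toℕ (adjacent-suc p) = cong suc (Adjacent-toℕ p)

Adjacent⇒≢ : ∀ {n} {a b : Fin n} → Adjacent a b → a ≢ b
Adjacent⇒≢ (adjacent-suc p) refl = Adjacent⇒≢ p refl

Adjacent-punchOut : ∀ {n} {a b c : Fin (suc n)} → Adjacent a b →
                    (c≢a : c ≢ a) (c≢b : c ≢ b) → Adjacent (punchOut c≢a) (punchOut c≢b)
Adjacent-punchOut {c = zero}     adjacent-zero    c≢a _ = ⊥-elim (c≢a refl)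
Adjacent-punchOut {c = zero}     (adjacent-suc p) _   _ = p
Adjacent-punchOut {c = suc zero} adjacent-zero    _ c≢b = ⊥-elim (c≢b refl)
Adjacent-punchOut {suc (suc n)} {c = suc (suc c)} adjacent-zero _ _ = adjacent-zero
Adjacent-punchOut {suc n} {c = suc c} (adjacent-suc p) c≢a c≢b =
  adjacent-suc (Adjacent-punchOut p (c≢a ∘ cong suc) (c≢b ∘ cong suc))

punchIn-Adjacent : ∀ {n} {A : Set} {a b : Fin (suc n)} → Adjacent a b → (v : Fin (suc n) → A) →
                   v a ≡ v b → ∀ y → v (punchIn a y) ≡ v (punchIn b y)
punchIn-Adjacent adjacent-zero    v va≡vb zero    = sym va≡vb
punchIn-Adjacent adjacent-zero    v va≡vb (suc y) = refl
punchIn-Adjacent {suc n} (adjacent-suc p) v va≡vb zero    = refl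
punchIn-Adjacent {suc n} (adjacent-suc p) v va≡vb (suc y) = punchIn-Adjacent p (v ∘ suc) va≡vb y

det-adjacent-equal-columns : ∀ {k} (M : Matrix k) {a b} → Adjacent a b →
                             (∀ i → M i a ≡ M i b) → det k M ≡ 0ℤ
det-adjacent-equal-columns {suc k} M {a} {b} adj a≗b = begin
  sumℤ (laplaceTerm M)                         ≡⟨ sumℤ-pair (laplaceTerm M) (Adjacent⇒≢ adj) others ⟩
  laplaceTerm M a + laplaceTerm M b            ≡⟨ cong₂ (λ s d → laplaceTerm M a + s * M zero b * d) sign-b minors ⟩
  s * M zero a * D + (- s) * M zero b * D      ≡⟨ cong (λ x → s * M zero a * D + (- s) * x * D) (a≗b zero) ⟨
  s * M zero a * D + (- s) * M zero a * D      ≡⟨ cancel s (M zero a) D ⟩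
  0ℤ                                           ∎
  where
  open ≡-Reasoning
  s : ℤ
  s = sign (toℕ a)
  D : ℤ
  D = det k (minor M zero a)
  sign-b : sign (toℕ b) ≡ - s
  sign-b = trans (cong sign (Adjacent-toℕ adj)) (sign-suc (toℕ a))
  minors : det k (minor M zero b) ≡ D
  minors = det-cong (λ x y → sym (punchIn-Adjacent adj (M (suc x)) (a≗b (suc x)) y))
  cancel : ∀ s x d → s * x * d + (- s) * x * d ≡ 0ℤ
  cancel = solve-∀
  others : ∀ c → c ≢ a → c ≢ b → laplaceTerm M c ≡ 0ℤ
  others c c≢a c≢b = laplaceTerm-zero-minor (sign (toℕ c)) (M zero c)
    (det-adjacent-equal-columns (minor M zero c) (Adjacent-punchOut adj c≢a c≢b)
      (λ x → trans (cong (M (suc x)) (punchIn-punchOut c≢a))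
                   (trans (a≗b (suc x)) (sym (cong (M (suc x)) (punchIn-punchOut c≢b))))))

-- W u v puts u and v into the two adjacent columns ending at b. Bilinearity turns det W(x+y, x+y) = 0
-- into det W(x, y) = det M plus three terms with equal columns that are adjacent or closer than a, b.
det-equal-columns-apart : ∀ d {k} (M : Matrix k) a b → suc (toℕ a ℕ.+ d) ≡ toℕ b →
                          (∀ i → M i a ≡ M i b) → det k M ≡ 0ℤ
det-equal-columns-apart zero M a b dist a≗b =
  det-adjacent-equal-columns M (toℕ-Adjacent a b (trans (cong suc (sym (ℕₚ.+-identityʳ (toℕ a)))) dist)) a≗b
det-equal-columns-apart (suc d) {k} M a (suc b) dist a≗b = begin
  det k M
    ≡⟨ det-cong (replaceColumns-same M x y (λ _ → refl) a≗b) ⟨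
  det k (W x y)
    ≡⟨ ℤₚ.+-identityˡ (det k (W x y)) ⟨
  0ℤ + det k (W x y)
    ≡⟨ cong (_+ det k (W x y)) (adjacent-equal x) ⟨
  det k (W x x) + det k (W x y)
    ≡⟨ ℤₚ.+-identityʳ (det k (W x x) + det k (W x y)) ⟨
  (det k (W x x) + det k (W x y)) + 0ℤ
    ≡⟨ cong (_+_ (det k (W x x) + det k (W x y))) (cong₂ _+_ (far-equal x) (far-equal y)) ⟨
  (det k (W x x) + det k (W x y)) + (det k (W y x) + det k (W y y))
    ≡⟨ det-replaceColumns-bilinear M c≢b′ x y ⟨
  det k (W x+y x+y)
    ≡⟨ adjacent-equal x+y ⟩
  0ℤ
    ∎
  where
  open ≡-Reasoning
  c : Fin k
  c = inject₁ b
  c-adjacent : Adjacent c (suc b)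
  c-adjacent = toℕ-Adjacent c (suc b) (cong suc (Finₚ.toℕ-inject₁ b))
  c≢b′ : c ≢ suc b
  c≢b′ = Adjacent⇒≢ c-adjacent
  dist-c : suc (toℕ a ℕ.+ d) ≡ toℕ c
  dist-c = trans (ℕₚ.suc-injective (trans (cong suc (sym (ℕₚ.+-suc (toℕ a) d))) dist))
                 (sym (Finₚ.toℕ-inject₁ b))
  a≢c : a ≢ c
  a≢c a≡c = ℕₚ.m≢1+m+n (toℕ a) (trans (cong toℕ a≡c) (sym dist-c))
  a≢b′ : a ≢ suc b
  a≢b′ a≡b′ = ℕₚ.m≢1+m+n (toℕ a) (trans (cong toℕ a≡b′) (sym dist))
  W : (Fin k → ℤ) → (Fin k → ℤ) → Matrix k
  W = replaceColumns M c (suc b)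
  x y x+y : Fin k → ℤ
  x i = M i c
  y i = M i a
  x+y i = x i + y i
  adjacent-equal : ∀ u → det k (W u u) ≡ 0ℤ
  adjacent-equal u = det-adjacent-equal-columns (W u u) c-adjacent
    (λ i → trans (replaceColumns-at₁ M {c} {suc b} u u i) (sym (replaceColumns-at₂ M c≢b′ u u i)))
  far-equal : ∀ v → det k (W y v) ≡ 0ℤ
  far-equal v = det-equal-columns-apart d (W y v) a c dist-c
    (λ i → trans (replaceColumns-other M y v i a≢c a≢b′) (sym (replaceColumns-at₁ M {c} {suc b} y v i)))

det-equal-columns : ∀ {k} (M : Matrix k) {a b} → a ≢ b → (∀ i → M i a ≡ M i b) → det k M ≡ 0ℤ
det-equal-columns M {a} {b} a≢b a≗b with ℕₚ.<-cmp (toℕ a) (toℕ b)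
... | tri< a<b _ _ = det-equal-columns-apart _ M a b (proj₂ (ℕₚ.m≤n⇒∃[o]m+o≡n a<b)) a≗b
... | tri≈ _ a≡b _ = ⊥-elim (a≢b (Finₚ.toℕ-injective a≡b))
... | tri> _ _ b<a = det-equal-columns-apart _ M b a (proj₂ (ℕₚ.m≤n⇒∃[o]m+o≡n b<a)) (sym ∘ a≗b)

det-proportional-columns : ∀ {k} (M : Matrix k) {j j′} → j ≢ j′ → ∀ c →
                           (∀ i → M i j′ ≡ c * M i j) → det k M ≡ 0ℤ
det-proportional-columns {k} M {j} {j′} j≢j′ c proportional = begin
  det k M                                         ≡⟨ det-cong rescaled ⟨
  det k (replaceColumn M j′ (λ i → c * M i j))    ≡⟨ det-replaceColumn-* M j′ c (λ i → M i j) ⟩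
  c * det k (replaceColumn M j′ (λ i → M i j))    ≡⟨ cong (c *_) (det-equal-columns _ j≢j′ equal) ⟩
  c * 0ℤ                                          ≡⟨ ℤₚ.*-zeroʳ c ⟩
  0ℤ                                              ∎
  where
  open ≡-Reasoning
  rescaled : ∀ i x → replaceColumn M j′ (λ y → c * M y j) i x ≡ M i x
  rescaled i x with x ≟ j′
  ... | yes refl = trans (replaceColumn-at M x (λ y → c * M y j) i) (sym (proportional i))
  ... | no x≢j′  = replaceColumn-other M (λ y → c * M y j) i x≢j′
  equal : ∀ i → replaceColumn M j′ (λ y → M y j) i j ≡ replaceColumn M j′ (λ y → M y j) i j′
  equal i = trans (replaceColumn-other M (λ y → M y j) i j≢j′) (sym (replaceColumn-at M j′ (λ y → M y j) i))

punchIn-punchOut-comm : ∀ {n} (j : Fin (suc (suc n))) (c : Fin (suc n)) (c≢j : punchIn j c ≢ j) (y : Fin n) →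
                        punchIn (punchIn j c) (punchIn (punchOut c≢j) y) ≡ punchIn j (punchIn c y)
punchIn-punchOut-comm zero          c       c≢j y       = refl
punchIn-punchOut-comm (suc j)       zero    c≢j y       = refl
punchIn-punchOut-comm {suc n} (suc j) (suc c) c≢j zero    = refl
punchIn-punchOut-comm {suc n} (suc j) (suc c) c≢j (suc y) = cong suc (punchIn-punchOut-comm j c (c≢j ∘ cong suc) y)

sign-punchIn-punchOut : ∀ {n} (j : Fin (suc (suc n))) (c : Fin (suc n)) (c≢j : punchIn j c ≢ j) →
                        sign (toℕ (punchIn j c)) * sign (toℕ (punchOut c≢j)) ≡ - (sign (toℕ j) * sign (toℕ c))
sign-punchIn-punchOut zero c c≢j = begin
  sign (suc (toℕ c)) * 1ℤ  ≡⟨ ℤₚ.*-identityʳ _ ⟩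
  sign (suc (toℕ c))       ≡⟨ sign-suc (toℕ c) ⟩
  - sign (toℕ c)           ≡⟨ cong -_ (ℤₚ.*-identityˡ (sign (toℕ c))) ⟨
  - (1ℤ * sign (toℕ c))    ∎
  where open ≡-Reasoning
sign-punchIn-punchOut (suc j) zero c≢j = begin
  1ℤ * sign (toℕ j)        ≡⟨ ℤₚ.*-identityˡ _ ⟩
  sign (toℕ j)             ≡⟨ ℤₚ.neg-involutive _ ⟨
  - - sign (toℕ j)         ≡⟨ cong -_ (sign-suc (toℕ j)) ⟨
  - sign (suc (toℕ j))     ≡⟨ cong -_ (ℤₚ.*-identityʳ _) ⟨
  - (sign (suc (toℕ j)) * 1ℤ) ∎
  where open ≡-Reasoning
sign-punchIn-punchOut {suc n} (suc j) (suc c) c≢j = begin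
  sign (suc (toℕ (punchIn j c))) * sign (suc (toℕ (punchOut c≢j′)))
    ≡⟨ cong₂ _*_ (sign-suc (toℕ (punchIn j c))) (sign-suc (toℕ (punchOut c≢j′))) ⟩
  - sign (toℕ (punchIn j c)) * - sign (toℕ (punchOut c≢j′))
    ≡⟨ neg*neg (sign (toℕ (punchIn j c))) (sign (toℕ (punchOut c≢j′))) ⟩
  sign (toℕ (punchIn j c)) * sign (toℕ (punchOut c≢j′))
    ≡⟨ sign-punchIn-punchOut j c c≢j′ ⟩
  - (sign (toℕ j) * sign (toℕ c))
    ≡⟨ cong -_ (neg*neg (sign (toℕ j)) (sign (toℕ c))) ⟨
  - (- sign (toℕ j) * - sign (toℕ c))
    ≡⟨ cong -_ (cong₂ _*_ (sign-suc (toℕ j)) (sign-suc (toℕ c))) ⟨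
  - (sign (suc (toℕ j)) * sign (suc (toℕ c))) ∎
  where
  open ≡-Reasoning
  c≢j′ : punchIn j c ≢ j
  c≢j′ = c≢j ∘ cong suc
  neg*neg : ∀ x y → - x * - y ≡ x * y
  neg*neg = solve-∀

sign-cofactor-punchIn : ∀ {n} m (j : Fin (suc (suc n))) (c : Fin (suc n)) (c≢j : punchIn j c ≢ j) →
                        sign (toℕ (punchIn j c)) * sign (m ℕ.+ toℕ (punchOut c≢j)) ≡ sign (suc m ℕ.+ toℕ j) * sign (toℕ c)
sign-cofactor-punchIn {n} m j c c≢j = begin
  sign (toℕ c′) * sign (m ℕ.+ toℕ j′)          ≡⟨ cong (sign (toℕ c′) *_) (sign-+ m (toℕ j′)) ⟩
  sign (toℕ c′) * (sign m * sign (toℕ j′))     ≡⟨ rotate (sign (toℕ c′)) (sign m) (sign (toℕ j′)) ⟩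
  sign m * (sign (toℕ c′) * sign (toℕ j′))     ≡⟨ cong (sign m *_) (sign-punchIn-punchOut j c c≢j) ⟩
  sign m * - (sign (toℕ j) * sign (toℕ c))     ≡⟨ negateˡ (sign m) (sign (toℕ j)) (sign (toℕ c)) ⟩
  - (sign m * sign (toℕ j)) * sign (toℕ c)     ≡⟨ cong (λ x → - x * sign (toℕ c)) (sign-+ m (toℕ j)) ⟨
  - sign (m ℕ.+ toℕ j) * sign (toℕ c)          ≡⟨ cong (_* sign (toℕ c)) (sign-suc (m ℕ.+ toℕ j)) ⟨
  sign (suc m ℕ.+ toℕ j) * sign (toℕ c)        ∎
  where
  open ≡-Reasoning
  c′ : Fin (suc (suc n))
  c′ = punchIn j c
  j′ : Fin (suc n)
  j′ = punchOut c≢j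
  rotate : ∀ a b c → a * (b * c) ≡ b * (a * c)
  rotate = solve-∀
  negateˡ : ∀ a b c → a * - (b * c) ≡ - (a * b) * c
  negateˡ = solve-∀

det-expand-unit-column : ∀ {k} (M : Matrix (suc k)) i j → (∀ x → x ≢ i → M x j ≡ 0ℤ) →
                         det (suc k) M ≡ sign (toℕ i ℕ.+ toℕ j) * M i j * det k (minor M i j)
det-expand-unit-column M zero j others = sumℤ-single j (laplaceTerm M) term≡0
  where
  term≡0 : ∀ c → c ≢ j → laplaceTerm M c ≡ 0ℤ
  term≡0 c c≢j = laplaceTerm-zero-minor (sign (toℕ c)) (M zero c)
    (det-zero-column (minor M zero c) (punchOut c≢j)
      (λ x → trans (cong (M (suc x)) (punchIn-punchOut c≢j)) (others (suc x) (λ ()))))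
det-expand-unit-column {suc k} M (suc i) j others = begin
  sumℤ (laplaceTerm M)                                      ≡⟨ sumℤ-remove j (laplaceTerm M) ⟩
  laplaceTerm M j + sumℤ (laplaceTerm M ∘ punchIn j)
    ≡⟨ cong₂ _+_ (laplaceTerm-zero-entry (sign (toℕ j)) _ (others zero (λ ()))) (sumℤ-cong term) ⟩
  0ℤ + sumℤ (λ c → s * laplaceTerm (minor M (suc i) j) c)   ≡⟨ ℤₚ.+-identityˡ _ ⟩
  sumℤ (λ c → s * laplaceTerm (minor M (suc i) j) c)        ≡⟨ sumℤ-*ˡ s (laplaceTerm (minor M (suc i) j)) ⟩
  s * det (suc k) (minor M (suc i) j)                       ∎
  where
  open ≡-Reasoning
  s : ℤ
  s = sign (toℕ (suc i) ℕ.+ toℕ j) * M (suc i) j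
  term : ∀ c → laplaceTerm M (punchIn j c) ≡ s * laplaceTerm (minor M (suc i) j) c
  term c = begin
    sign (toℕ c′) * M zero c′ * det (suc k) (minor M zero c′)
      ≡⟨ cong (sign (toℕ c′) * M zero c′ *_) (trans expanded (cong (σ * M (suc i) j *_) minors)) ⟩
    sign (toℕ c′) * M zero c′ * (σ * M (suc i) j * D)
      ≡⟨ regroup (sign (toℕ c′)) (M zero c′) σ (M (suc i) j) D ⟩
    (sign (toℕ c′) * σ) * (M (suc i) j * (M zero c′ * D))
      ≡⟨ cong (_* (M (suc i) j * (M zero c′ * D))) (sign-cofactor-punchIn (toℕ i) j c c′≢j) ⟩
    (sign (toℕ (suc i) ℕ.+ toℕ j) * sign (toℕ c)) * (M (suc i) j * (M zero c′ * D))
      ≡⟨ regroup′ (sign (toℕ (suc i) ℕ.+ toℕ j)) (sign (toℕ c)) (M (suc i) j) (M zero c′) D ⟩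
    s * (sign (toℕ c) * M zero c′ * D) ∎
    where
    c′ : Fin (suc (suc k))
    c′ = punchIn j c
    c′≢j : c′ ≢ j
    c′≢j = punchInᵢ≢i j c
    j′ : Fin (suc k)
    j′ = punchOut c′≢j
    σ : ℤ
    σ = sign (toℕ i ℕ.+ toℕ j′)
    D : ℤ
    D = det k (minor (minor M (suc i) j) zero c)
    expanded : det (suc k) (minor M zero c′) ≡ σ * M (suc i) j * det k (minor (minor M zero c′) i j′)
    expanded = trans (det-expand-unit-column (minor M zero c′) i j′
                        (λ x x≢i → trans (cong (M (suc x)) (punchIn-punchOut c′≢j)) (others (suc x) (x≢i ∘ Finₚ.suc-injective))))
                     (cong (λ m → σ * m * det k (minor (minor M zero c′) i j′)) (cong (M (suc i)) (punchIn-punchOut c′≢j)))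
    minors : det k (minor (minor M zero c′) i j′) ≡ D
    minors = det-cong (λ x y → cong (M (suc (punchIn i x))) (punchIn-punchOut-comm j c c′≢j y))
    regroup : ∀ t m σ u d → t * m * (σ * u * d) ≡ (t * σ) * (u * (m * d))
    regroup = solve-∀
    regroup′ : ∀ σ t u m d → (σ * t) * (u * (m * d)) ≡ σ * u * (t * m * d)
    regroup′ = solve-∀

_ᵀ : ∀ {k} → Matrix k → Matrix k
(M ᵀ) i j = M j i

crossTerm : ∀ {k} → Matrix (suc (suc k)) → Fin (suc k) → Fin (suc k) → ℤ
crossTerm {k} N j i = sign (toℕ (suc j)) * sign (toℕ i) * N zero (suc j) * N (suc i) zero *
                      det k (minor (minor N zero (suc j)) i zero)

-- Transposition at the two smaller sizes is an argument so that det-transpose can recurse through it.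
det-expand-first-row-and-column :
  ∀ {k} → (∀ (A : Matrix (suc k)) → det (suc k) (A ᵀ) ≡ det (suc k) A) →
  (∀ (A : Matrix k) → det k (A ᵀ) ≡ det k A) → (N : Matrix (suc (suc k))) →
  det (suc (suc k)) N ≡ N zero zero * det (suc k) (minor N zero zero) + sumℤ (λ j → sumℤ (crossTerm N j))
det-expand-first-row-and-column {k} transpose-suc transpose N =
  cong₂ _+_ (cong (_* det (suc k) (minor N zero zero)) (ℤₚ.*-identityˡ (N zero zero))) (sumℤ-cong expand-term)
  where
  open ≡-Reasoning
  expand-first-column : (A : Matrix (suc k)) →
                        det (suc k) A ≡ sumℤ (λ i → sign (toℕ i) * A i zero * det k (minor A i zero))
  expand-first-column A = trans (sym (transpose-suc A))
    (sumℤ-cong λ i → cong (sign (toℕ i) * A i zero *_) (transpose (minor A i zero)))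
  expand-term : ∀ j → laplaceTerm N (suc j) ≡ sumℤ (crossTerm N j)
  expand-term j = begin
    s * N zero (suc j) * det (suc k) (minor N zero (suc j))
      ≡⟨ cong (s * N zero (suc j) *_) (expand-first-column (minor N zero (suc j))) ⟩
    s * N zero (suc j) * sumℤ (λ i → sign (toℕ i) * N (suc i) zero * D i)
      ≡⟨ sumℤ-*ˡ (s * N zero (suc j)) (λ i → sign (toℕ i) * N (suc i) zero * D i) ⟨
    sumℤ (λ i → s * N zero (suc j) * (sign (toℕ i) * N (suc i) zero * D i))
      ≡⟨ sumℤ-cong (λ i → regroup s (N zero (suc j)) (sign (toℕ i)) (N (suc i) zero) (D i)) ⟩
    sumℤ (crossTerm N j) ∎
    where
    s : ℤ
    s = sign (toℕ (suc j))
    D : Fin (suc k) → ℤ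
    D i = det k (minor (minor N zero (suc j)) i zero)
    regroup : ∀ s x t y d → s * x * (t * y * d) ≡ s * t * x * y * d
    regroup = solve-∀

det-transpose : ∀ k (M : Matrix k) → det k (M ᵀ) ≡ det k M
det-transpose zero          M = refl
det-transpose (suc zero)    M = refl
det-transpose (suc (suc k)) M = begin
  det (suc (suc k)) (M ᵀ)
    ≡⟨ det-expand-first-row-and-column (det-transpose (suc k)) (det-transpose k) (M ᵀ) ⟩
  M zero zero * det (suc k) ((minor M zero zero) ᵀ) + sumℤ (λ j → sumℤ (crossTerm (M ᵀ) j))
    ≡⟨ cong₂ _+_ (cong (M zero zero *_) (det-transpose (suc k) (minor M zero zero)))
                 (trans (sumℤ-comm (crossTerm (M ᵀ))) (sumℤ-cong λ i → sumℤ-cong λ j → crossTerm-transpose i j)) ⟩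
  M zero zero * det (suc k) (minor M zero zero) + sumℤ (λ i → sumℤ (crossTerm M i))
    ≡⟨ det-expand-first-row-and-column (det-transpose (suc k)) (det-transpose k) M ⟨
  det (suc (suc k)) M ∎
  where
  open ≡-Reasoning
  crossTerm-transpose : ∀ i j → crossTerm (M ᵀ) j i ≡ crossTerm M i j
  crossTerm-transpose i j = begin
    sign (toℕ (suc j)) * sign (toℕ i) * M (suc j) zero * M zero (suc i) * Dᵀ
      ≡⟨ cong (sign (toℕ (suc j)) * sign (toℕ i) * M (suc j) zero * M zero (suc i) *_)
              (det-transpose k (minor (minor M zero (suc i)) j zero)) ⟩
    sign (toℕ (suc j)) * sign (toℕ i) * M (suc j) zero * M zero (suc i) * D
      ≡⟨ reorder (sign (toℕ (suc j))) (sign (toℕ i)) (M zero (suc i)) (M (suc j) zero) D ⟩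
    (sign (toℕ (suc j)) * sign (toℕ i)) * (M zero (suc i) * M (suc j) zero * D)
      ≡⟨ cong (_* (M zero (suc i) * M (suc j) zero * D)) (sign-swap (toℕ j) (toℕ i)) ⟩
    (sign (toℕ (suc i)) * sign (toℕ j)) * (M zero (suc i) * M (suc j) zero * D)
      ≡⟨ regroup (sign (toℕ (suc i))) (sign (toℕ j)) (M zero (suc i)) (M (suc j) zero) D ⟨
    sign (toℕ (suc i)) * sign (toℕ j) * M zero (suc i) * M (suc j) zero * D ∎
    where
    D Dᵀ : ℤ
    D = det k (minor (minor M zero (suc i)) j zero)
    Dᵀ = det k ((minor (minor M zero (suc i)) j zero) ᵀ)
    reorder : ∀ s t x y d → s * t * y * x * d ≡ (s * t) * (x * y * d)
    reorder = solve-∀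
    regroup : ∀ s t x y d → s * t * x * y * d ≡ (s * t) * (x * y * d)
    regroup = solve-∀
    sign-swap : ∀ m n → sign (suc m) * sign n ≡ sign (suc n) * sign m
    sign-swap m n = begin
      sign (suc m) * sign n  ≡⟨ cong (_* sign n) (sign-suc m) ⟩
      - sign m * sign n      ≡⟨ negate-swap (sign m) (sign n) ⟩
      - sign n * sign m      ≡⟨ cong (_* sign m) (sign-suc n) ⟨
      sign (suc n) * sign m  ∎
      where
      negate-swap : ∀ x y → - x * y ≡ - y * x
      negate-swap = solve-∀

det-zero-row : ∀ {k} (M : Matrix k) i → (∀ j → M i j ≡ 0ℤ) → det k M ≡ 0ℤ
det-zero-row {k} M i row≡0 = trans (sym (det-transpose k M)) (det-zero-column (M ᵀ) i row≡0)

det-equal-rows : ∀ {k} (M : Matrix k) {a b} → a ≢ b → (∀ j → M a j ≡ M b j) → det k M ≡ 0ℤ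
det-equal-rows {k} M a≢b a≗b = trans (sym (det-transpose k M)) (det-equal-columns (M ᵀ) a≢b a≗b)

det-expand-unit-row : ∀ {k} (M : Matrix (suc k)) i j → (∀ y → y ≢ j → M i y ≡ 0ℤ) →
                      det (suc k) M ≡ sign (toℕ i ℕ.+ toℕ j) * M i j * det k (minor M i j)
det-expand-unit-row {k} M i j others = begin
  det (suc k) M                                            ≡⟨ det-transpose (suc k) M ⟨
  det (suc k) (M ᵀ)                                        ≡⟨ det-expand-unit-column (M ᵀ) j i others ⟩
  sign (toℕ j ℕ.+ toℕ i) * M i j * det k ((minor M i j) ᵀ) ≡⟨ cong₂ (λ s d → s * M i j * d)
                                                                     (cong sign (ℕₚ.+-comm (toℕ j) (toℕ i)))
                                                                     (det-transpose k (minor M i j)) ⟩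
  sign (toℕ i ℕ.+ toℕ j) * M i j * det k (minor M i j)     ∎
  where open ≡-Reasoning

det-replaceColumn-sum : ∀ {k} (M : Matrix k) j {n} (g : Fin n → Fin k → ℤ) →
  det k (replaceColumn M j (λ i → sumℤ (λ t → g t i))) ≡ sumℤ (λ t → det k (replaceColumn M j (g t)))
det-replaceColumn-sum M j {zero}  g = det-zero-column _ j (replaceColumn-at M j (λ _ → 0ℤ))
det-replaceColumn-sum {k} M j {suc n} g =
  trans (det-replaceColumn-+ M j (g zero) (λ i → sumℤ (λ t → g (suc t) i)))
        (cong (_+_ (det k (replaceColumn M j (g zero)))) (det-replaceColumn-sum M j (g ∘ suc)))

det-replaceColumn-combination : ∀ {k} (M : Matrix k) j (a : Fin k → ℤ) →
  det k (replaceColumn M j (λ i → sumℤ (λ l → a l * M i l))) ≡ a j * det k M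
det-replaceColumn-combination {k} M j a = begin
  det k (replaceColumn M j (λ i → sumℤ (λ l → a l * M i l)))
    ≡⟨ det-replaceColumn-sum M j (λ l i → a l * M i l) ⟩
  sumℤ (λ l → det k (replaceColumn M j (λ i → a l * M i l)))
    ≡⟨ sumℤ-cong (λ l → det-replaceColumn-* M j (a l) (λ i → M i l)) ⟩
  sumℤ (λ l → a l * det k (replaceColumn M j (λ i → M i l)))
    ≡⟨ sumℤ-single j _ (λ l l≢j → trans (cong (a l *_) (repeated-column l l≢j)) (ℤₚ.*-zeroʳ (a l))) ⟩
  a j * det k (replaceColumn M j (λ i → M i j))
    ≡⟨ cong (a j *_) (det-cong (replaceColumn-same M j)) ⟩
  a j * det k M ∎
  where
  open ≡-Reasoning
  repeated-column : ∀ l → l ≢ j → det k (replaceColumn M j (λ i → M i l)) ≡ 0ℤ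
  repeated-column l l≢j = det-equal-columns _ (l≢j ∘ sym)
    (λ i → trans (replaceColumn-at M j (λ x → M x l) i) (sym (replaceColumn-other M (λ x → M x l) i l≢j)))

det-dependent-columns : ∀ {k} (M : Matrix k) (a : Fin k → ℤ) j → IsUnit (a j) →
                        (∀ i → sumℤ (λ l → a l * M i l) ≡ 0ℤ) → det k M ≡ 0ℤ
det-dependent-columns {k} M a j a-unit combination≡0 = IsUnit-*-cancel a-unit (begin
  a j * det k M                                               ≡⟨ det-replaceColumn-combination M j a ⟨
  det k (replaceColumn M j (λ i → sumℤ (λ l → a l * M i l)))  ≡⟨ det-zero-column _ j zero-column ⟩
  0ℤ                                                          ∎)
  where
  open ≡-Reasoning
  zero-column : ∀ i → replaceColumn M j (λ x → sumℤ (λ l → a l * M x l)) i j ≡ 0ℤ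
  zero-column i = trans (replaceColumn-at M j (λ x → sumℤ (λ l → a l * M x l)) i) (combination≡0 i)

det-add-combination : ∀ {k} (M : Matrix k) j (a : Fin k → ℤ) → a j ≡ 0ℤ →
  det k (replaceColumn M j (λ i → M i j + sumℤ (λ l → a l * M i l))) ≡ det k M
det-add-combination {k} M j a aj≡0 = begin
  det k (replaceColumn M j (λ i → M i j + sumℤ (λ l → a l * M i l)))
    ≡⟨ det-replaceColumn-+ M j (λ i → M i j) (λ i → sumℤ (λ l → a l * M i l)) ⟩
  det k (replaceColumn M j (λ i → M i j)) + det k (replaceColumn M j (λ i → sumℤ (λ l → a l * M i l)))
    ≡⟨ cong₂ _+_ (det-cong (replaceColumn-same M j)) (det-replaceColumn-combination M j a) ⟩
  det k M + a j * det k M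
    ≡⟨ cong (λ x → det k M + x * det k M) aj≡0 ⟩
  det k M + 0ℤ * det k M
    ≡⟨ cong (_+_ (det k M)) (ℤₚ.*-zeroˡ (det k M)) ⟩
  det k M + 0ℤ
    ≡⟨ ℤₚ.+-identityʳ (det k M) ⟩
  det k M ∎
  where open ≡-Reasoning

-- `partial t` replaces the first t columns; A j l ≠ 0 only for columns l that are never replaced,
-- so each step is a single column operation.
module AddCombinations {k} (M : Matrix k) (A : Fin k → Fin k → ℤ)
                       (only-fixed : ∀ j l → A j l ≡ 0ℤ ⊎ (∀ m → A l m ≡ 0ℤ)) where

  updated : Matrix k
  updated i j = M i j + sumℤ (λ l → A j l * M i l)

  partial : ℕ → Matrix k
  partial t i j = if does (toℕ j ℕ.<? t) then updated i j else M i j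

  partial-fixed : ∀ t l → (∀ m → A l m ≡ 0ℤ) → ∀ i → partial t i l ≡ M i l
  partial-fixed t l A-l≡0 i with does (toℕ l ℕ.<? t)
  ... | true  = trans (cong (_+_ (M i l)) (sumℤ-zero (λ m → trans (cong (_* M i m) (A-l≡0 m)) (ℤₚ.*-zeroˡ (M i m)))))
                      (ℤₚ.+-identityʳ (M i l))
  ... | false = refl

  partial-combination : ∀ t j i → sumℤ (λ l → A j l * partial t i l) ≡ sumℤ (λ l → A j l * M i l)
  partial-combination t j i = sumℤ-cong term
    where
    term : ∀ l → A j l * partial t i l ≡ A j l * M i l
    term l with only-fixed j l
    ... | inj₁ A-jl≡0 = trans (cong (_* partial t i l) A-jl≡0) (sym (cong (_* M i l) A-jl≡0))
    ... | inj₂ A-l≡0  = cong (A j l *_) (partial-fixed t l A-l≡0 i)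

  partial-step : ∀ t (t<k : t ℕ.< k) i j →
    partial (suc t) i j ≡ replaceColumn (partial t) (Fin.fromℕ< t<k)
                            (λ x → partial t x (Fin.fromℕ< t<k) + sumℤ (λ l → A (Fin.fromℕ< t<k) l * partial t x l)) i j
  partial-step t t<k i j with j ≟ Fin.fromℕ< t<k
  ... | yes refl = begin
    partial (suc t) i j                                 ≡⟨ cong (λ b → if b then updated i j else M i j)
                                                                (dec-true (toℕ j ℕ.<? suc t) (ℕₚ.≤-reflexive (cong suc toℕ-j))) ⟩
    M i j + sumℤ (λ l → A j l * M i l)                  ≡⟨ cong₂ _+_ (sym not-yet) (sym (partial-combination t j i)) ⟩
    partial t i j + sumℤ (λ l → A j l * partial t i l)  ≡⟨ replaceColumn-at (partial t) j new-column i ⟨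
    replaceColumn (partial t) j new-column i j          ∎
    where
    open ≡-Reasoning
    new-column : Fin k → ℤ
    new-column x = partial t x j + sumℤ (λ l → A j l * partial t x l)
    toℕ-j : toℕ j ≡ t
    toℕ-j = Finₚ.toℕ-fromℕ< t<k
    not-yet : partial t i j ≡ M i j
    not-yet = cong (λ b → if b then updated i j else M i j) (dec-false (toℕ j ℕ.<? t) (ℕₚ.<-irrefl toℕ-j))
  ... | no j≢c = trans (cong (λ b → if b then updated i j else M i j) same-decision)
                       (sym (replaceColumn-other (partial t) new-column i j≢c))
    where
    c : Fin k
    c = Fin.fromℕ< t<k
    new-column : Fin k → ℤ
    new-column x = partial t x c + sumℤ (λ l → A c l * partial t x l)
    toℕ-j≢t : toℕ j ≢ t
    toℕ-j≢t eq = j≢c (Finₚ.toℕ-injective (trans eq (sym (Finₚ.toℕ-fromℕ< t<k))))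
    same-decision : does (toℕ j ℕ.<? suc t) ≡ does (toℕ j ℕ.<? t)
    same-decision with toℕ j ℕ.<? t
    ... | yes j<t = trans (dec-true (toℕ j ℕ.<? suc t) (ℕₚ.m<n⇒m<1+n j<t)) (sym (dec-true (toℕ j ℕ.<? t) j<t))
    ... | no  j≮t = trans (dec-false (toℕ j ℕ.<? suc t) λ j<1+t → [ j≮t , toℕ-j≢t ]′ (ℕₚ.m<1+n⇒m<n∨m≡n j<1+t))
                          (sym (dec-false (toℕ j ℕ.<? t) j≮t))

  det-partial : ∀ t → t ℕ.≤ k → det k (partial t) ≡ det k M
  det-partial zero    _   = refl
  det-partial (suc t) t<k = begin
    det k (partial (suc t))  ≡⟨ det-cong (partial-step t t<k) ⟩
    det k (replaceColumn (partial t) c (λ x → partial t x c + sumℤ (λ l → A c l * partial t x l)))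
                             ≡⟨ det-add-combination (partial t) c (A c) diagonal ⟩
    det k (partial t)        ≡⟨ det-partial t (ℕₚ.<⇒≤ t<k) ⟩
    det k M                  ∎
    where
    open ≡-Reasoning
    c : Fin k
    c = Fin.fromℕ< t<k
    diagonal : A c c ≡ 0ℤ
    diagonal with only-fixed c c
    ... | inj₁ A-cc≡0 = A-cc≡0
    ... | inj₂ A-c≡0  = A-c≡0 c

  det-add-combinations : det k updated ≡ det k M
  det-add-combinations =
    trans (sym (det-cong (λ i j → cong (λ b → if b then updated i j else M i j) (dec-true (toℕ j ℕ.<? k) (Finₚ.toℕ<n j)))))
          (det-partial k ℕₚ.≤-refl)

open AddCombinations using (det-add-combinations)

-- Matrices with bipartite row patterns

ZeroOrUnit-det-sparse-row : ∀ {k} (M : Matrix (suc k)) i →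
  (∀ j j′ → M i j ≢ 0ℤ → M i j′ ≢ 0ℤ → j ≡ j′) → (∀ j → M i j ≢ 0ℤ → IsUnit (M i j)) →
  (∀ j → ZeroOrUnit (det k (minor M i j))) → ZeroOrUnit (det (suc k) M)
ZeroOrUnit-det-sparse-row M i sparse unit minors with any? (λ j → ¬? (M i j ℤ.≟ 0ℤ))
... | no all-zero  = inj₁ (det-zero-row M i (λ j → decidable-stable (M i j ℤ.≟ 0ℤ) (λ nz → all-zero (j , nz))))
... | yes (j , nz) = subst ZeroOrUnit (sym (det-expand-unit-row M i j others))
                       (ZeroOrUnit-* (ZeroOrUnit-* (inj₂ (sign-isUnit (toℕ i ℕ.+ toℕ j))) (inj₂ (unit j nz))) (minors j))
  where
  others : ∀ y → y ≢ j → M i y ≡ 0ℤ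
  others y y≢j = decidable-stable (M i y ℤ.≟ 0ℤ) (λ nz′ → y≢j (sparse y j nz′ nz))

ZeroOrUnit-det-sparse-column : ∀ {k} (M : Matrix (suc k)) j →
  (∀ i i′ → M i j ≢ 0ℤ → M i′ j ≢ 0ℤ → i ≡ i′) → (∀ i → M i j ≢ 0ℤ → IsUnit (M i j)) →
  (∀ i → ZeroOrUnit (det k (minor M i j))) → ZeroOrUnit (det (suc k) M)
ZeroOrUnit-det-sparse-column M j sparse unit minors with any? (λ i → ¬? (M i j ℤ.≟ 0ℤ))
... | no all-zero  = inj₁ (det-zero-column M j (λ i → decidable-stable (M i j ℤ.≟ 0ℤ) (λ nz → all-zero (i , nz))))
... | yes (i , nz) = subst ZeroOrUnit (sym (det-expand-unit-column M i j others))
                       (ZeroOrUnit-* (ZeroOrUnit-* (inj₂ (sign-isUnit (toℕ i ℕ.+ toℕ j))) (inj₂ (unit i nz))) (minors i))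
  where
  others : ∀ x → x ≢ i → M x j ≡ 0ℤ
  others x x≢i = decidable-stable (M x j ℤ.≟ 0ℤ) (λ nz′ → x≢i (sparse x i nz′ nz))

record BipartiteRows {k} (M : Matrix k) : Set where
  field
    columnSign   : Fin k → ℤ
    side         : Fin k → Bool
    columnSign-unit : ∀ j → IsUnit (columnSign j)
    entry        : ∀ i j → M i j ≡ 0ℤ ⊎ M i j ≡ columnSign j
    one-per-side : ∀ i j j′ → M i j ≢ 0ℤ → M i j′ ≢ 0ℤ → side j ≡ side j′ → j ≡ j′

BipartiteRows-minor : ∀ {k} {M : Matrix (suc k)} → BipartiteRows M → ∀ i j → BipartiteRows (minor M i j)
BipartiteRows-minor B i j = record
  { columnSign      = columnSign ∘ punchIn j
  ; side            = side ∘ punchIn j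
  ; columnSign-unit = columnSign-unit ∘ punchIn j
  ; entry           = λ x y → entry (punchIn i x) (punchIn j y)
  ; one-per-side    = λ x y y′ nz nz′ same → punchIn-injective j y y′ (one-per-side (punchIn i x) _ _ nz nz′ same)
  }
  where open BipartiteRows B

module _ {k} {M : Matrix (suc k)} (B : BipartiteRows M) where
  open BipartiteRows B

  Reaches : Fin (suc k) → Bool → Set
  Reaches i b = ∃ λ j → M i j ≢ 0ℤ × side j ≡ b

  reaches? : ∀ i b → Dec (Reaches i b)
  reaches? i b = any? (λ j → ¬? (M i j ℤ.≟ 0ℤ) ×-dec (side j Bool.≟ b))

  TwoSided : Fin (suc k) → Set
  TwoSided i = Reaches i true × Reaches i false

  two-sided? : ∀ i → Dec (TwoSided i)
  two-sided? i = reaches? i true ×-dec reaches? i false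

  nonzero⇒columnSign : ∀ i j → M i j ≢ 0ℤ → M i j ≡ columnSign j
  nonzero⇒columnSign i j nz with entry i j
  ... | inj₁ z = ⊥-elim (nz z)
  ... | inj₂ e = e

  two-sided⇒det≡0 : (∀ i → TwoSided i) → det (suc k) M ≡ 0ℤ
  two-sided⇒det≡0 two-sided = det-dependent-columns M a zero (a-unit zero) balanced
    where
    a : Fin (suc k) → ℤ
    a l = if side l then columnSign l else - columnSign l
    a-unit : ∀ l → IsUnit (a l)
    a-unit l with side l
    ... | true  = columnSign-unit l
    ... | false = IsUnit-neg (columnSign-unit l)
    balanced : ∀ i → sumℤ (λ l → a l * M i l) ≡ 0ℤ
    balanced i with two-sided i
    ... | (u , u-nz , u-true) , (w , w-nz , w-false) = begin
      sumℤ (λ l → a l * M i l)   ≡⟨ sumℤ-pair (λ l → a l * M i l) u≢w others ⟩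
      a u * M i u + a w * M i w  ≡⟨ cong₂ _+_ u-term w-term ⟩
      1ℤ + -1ℤ                   ≡⟨⟩
      0ℤ                         ∎
      where
      open ≡-Reasoning
      u≢w : u ≢ w
      u≢w refl with trans (sym u-true) w-false
      ... | ()
      u-term : a u * M i u ≡ 1ℤ
      u-term rewrite u-true = trans (cong (columnSign u *_) (nonzero⇒columnSign i u u-nz)) (IsUnit-square (columnSign-unit u))
      w-term : a w * M i w ≡ -1ℤ
      w-term rewrite w-false = begin
        - columnSign w * M i w           ≡⟨ cong (- columnSign w *_) (nonzero⇒columnSign i w w-nz) ⟩
        - columnSign w * columnSign w    ≡⟨ ℤₚ.neg-distribˡ-* (columnSign w) (columnSign w) ⟨
        - (columnSign w * columnSign w)  ≡⟨ cong -_ (IsUnit-square (columnSign-unit w)) ⟩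
        -1ℤ                              ∎
      others : ∀ l → l ≢ u → l ≢ w → a l * M i l ≡ 0ℤ
      others l l≢u l≢w with M i l ℤ.≟ 0ℤ
      ... | yes z  = trans (cong (a l *_) z) (ℤₚ.*-zeroʳ (a l))
      ... | no nz  with side l in side-l
      ...   | true  = ⊥-elim (l≢u (one-per-side i l u nz u-nz (trans side-l (sym u-true))))
      ...   | false = ⊥-elim (l≢w (one-per-side i l w nz w-nz (trans side-l (sym w-false))))

  one-sided⇒sparse : ∀ i → ¬ TwoSided i →
                     ∀ j j′ → M i j ≢ 0ℤ → M i j′ ≢ 0ℤ → j ≡ j′
  one-sided⇒sparse i one-sided j j′ nz nz′ = one-per-side i j j′ nz nz′ same-side
    where
    same-side : side j ≡ side j′
    same-side with side j in side-j | side j′ in side-j′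
    ... | true  | true  = refl
    ... | false | false = refl
    ... | true  | false = ⊥-elim (one-sided ((j , nz , side-j) , (j′ , nz′ , side-j′)))
    ... | false | true  = ⊥-elim (one-sided ((j′ , nz′ , side-j′) , (j , nz , side-j)))

  nonzero⇒unit : ∀ i j → M i j ≢ 0ℤ → IsUnit (M i j)
  nonzero⇒unit i j nz = subst IsUnit (sym (nonzero⇒columnSign i j nz)) (columnSign-unit j)

BipartiteRows⇒ZeroOrUnit : ∀ {k} {M : Matrix k} → BipartiteRows M → ZeroOrUnit (det k M)
BipartiteRows⇒ZeroOrUnit {zero}      _ = inj₂ (inj₁ refl)
BipartiteRows⇒ZeroOrUnit {suc k} {M} B with all? (two-sided? B)
... | yes two-sided = inj₁ (two-sided⇒det≡0 B two-sided)
... | no ¬two-sided with ¬∀⟶∃¬ (suc k) _ (two-sided? B) ¬two-sided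
...   | i , one-sided = ZeroOrUnit-det-sparse-row M i (one-sided⇒sparse B i one-sided) (nonzero⇒unit B i)
                          (λ j → BipartiteRows⇒ZeroOrUnit (BipartiteRows-minor B i j))

-- Lattice points

module ∑ℚ = SemiringSum (Ring.semiring ℚₚ.+-*-ring)

sumℚ≡∑ : ∀ {n} (f : Fin n → ℚ) → sumℚ f ≡ ∑ℚ.sum f
sumℚ≡∑ {zero}  f = refl
sumℚ≡∑ {suc n} f = cong (f zero ℚ.+_) (sumℚ≡∑ (f ∘ suc))

∑ℚ-mono-≤ : ∀ {n} {f g : Fin n → ℚ} → (∀ i → f i ℚ.≤ g i) → ∑ℚ.sum f ℚ.≤ ∑ℚ.sum g
∑ℚ-mono-≤ {zero}  f≤g = ℚₚ.≤-refl
∑ℚ-mono-≤ {suc n} f≤g = ℚₚ.+-mono-≤ (f≤g zero) (∑ℚ-mono-≤ (f≤g ∘ suc))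

toℚᵘ-toℚ : ∀ z → toℚᵘ (toℚ z) ≃ᵘ mkℚᵘ z 0
toℚᵘ-toℚ z = ℚₚ.toℚᵘ-fromℚᵘ (mkℚᵘ z 0)

toℚ-+ : ∀ a b → toℚ (a ℤ.+ b) ≡ toℚ a ℚ.+ toℚ b
toℚ-+ a b = ℚₚ.toℚᵘ-injective
  (ℚᵘₚ.≃-trans (toℚᵘ-toℚ (a ℤ.+ b))
  (ℚᵘₚ.≃-trans (*≡* (unit-denominators a b))
               (ℚᵘₚ.≃-sym (ℚᵘₚ.≃-trans (ℚₚ.toℚᵘ-homo-+ (toℚ a) (toℚ b)) (ℚᵘₚ.+-cong (toℚᵘ-toℚ a) (toℚᵘ-toℚ b))))))
  where
  unit-denominators : ∀ a b → (a ℤ.+ b) ℤ.* 1ℤ ≡ (a ℤ.* 1ℤ ℤ.+ b ℤ.* 1ℤ) ℤ.* 1ℤ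
  unit-denominators = solve-∀

toℚ-* : ∀ a b → toℚ (a ℤ.* b) ≡ toℚ a ℚ.* toℚ b
toℚ-* a b = ℚₚ.toℚᵘ-injective
  (ℚᵘₚ.≃-trans (toℚᵘ-toℚ (a ℤ.* b))
               (ℚᵘₚ.≃-sym (ℚᵘₚ.≃-trans (ℚₚ.toℚᵘ-homo-* (toℚ a) (toℚ b)) (ℚᵘₚ.*-cong (toℚᵘ-toℚ a) (toℚᵘ-toℚ b)))))

toℚ-mono-≤ : ∀ {a b} → a ℤ.≤ b → toℚ a ℚ.≤ toℚ b
toℚ-mono-≤ {a} {b} a≤b = ℚₚ.toℚᵘ-cancel-≤
  (ℚᵘₚ.≤-respˡ-≃ (ℚᵘₚ.≃-sym (toℚᵘ-toℚ a)) (ℚᵘₚ.≤-respʳ-≃ (ℚᵘₚ.≃-sym (toℚᵘ-toℚ b))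
    (*≤* (subst₂ ℤ._≤_ (sym (ℤₚ.*-identityʳ a)) (sym (ℤₚ.*-identityʳ b)) a≤b))))

toℚ-cancel-≤ : ∀ {a b} → toℚ a ℚ.≤ toℚ b → a ℤ.≤ b
toℚ-cancel-≤ {a} {b} a≤b with ℚᵘₚ.≤-respˡ-≃ (toℚᵘ-toℚ a) (ℚᵘₚ.≤-respʳ-≃ (toℚᵘ-toℚ b) (ℚₚ.toℚᵘ-mono-≤ a≤b))
... | *≤* a*1≤b*1 = subst₂ ℤ._≤_ (ℤₚ.*-identityʳ a) (ℤₚ.*-identityʳ b) a*1≤b*1

toℚ-sumℤ : ∀ {n} (f : Fin n → ℤ) → toℚ (sumℤ f) ≡ ∑ℚ.sum (toℚ ∘ f)
toℚ-sumℤ {zero}  f = refl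
toℚ-sumℤ {suc n} f = trans (toℚ-+ (f zero) (sumℤ (f ∘ suc))) (cong (toℚ (f zero) ℚ.+_) (toℚ-sumℤ (f ∘ suc)))

IsLatticePoint⇒valid : ∀ (P : PointConfig) z → IsLatticePoint P z →
  ∀ {n} (f : Fin n → ℤ) (u : Fin n → Fin (dim P)) β →
  (∀ x → sumℤ (λ t → f t ℤ.* pt P x (u t)) ℤ.≤ β) → sumℤ (λ t → f t ℤ.* z (u t)) ℤ.≤ β
IsLatticePoint⇒valid P z (λ′ , λ′≥0 , λ′-sum , λ′-combination) {n} f u β valid = toℚ-cancel-≤ (begin
  toℚ (sumℤ (λ t → f t ℤ.* z (u t)))
    ≡⟨ toℚ-sumℤ (λ t → f t ℤ.* z (u t)) ⟩
  ∑ℚ.sum (λ t → toℚ (f t ℤ.* z (u t)))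
    ≡⟨ ∑ℚ.sum-cong-≗ (λ t → trans (toℚ-* (f t) (z (u t))) (cong (toℚ (f t) ℚ.*_) (combination (u t)))) ⟩
  ∑ℚ.sum (λ t → toℚ (f t) ℚ.* ∑ℚ.sum (λ x → λ′ x ℚ.* value x t))
    ≡⟨ ∑ℚ.sum-cong-≗ (λ t → ∑ℚ.*-distribˡ-sum (toℚ (f t)) (λ x → λ′ x ℚ.* value x t)) ⟩
  ∑ℚ.sum (λ t → ∑ℚ.sum (λ x → toℚ (f t) ℚ.* (λ′ x ℚ.* value x t)))
    ≡⟨ ∑ℚ.∑-comm (λ t x → toℚ (f t) ℚ.* (λ′ x ℚ.* value x t)) ⟩
  ∑ℚ.sum (λ x → ∑ℚ.sum (λ t → toℚ (f t) ℚ.* (λ′ x ℚ.* value x t)))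
    ≡⟨ ∑ℚ.sum-cong-≗ (λ x → trans (∑ℚ.sum-cong-≗ (λ t → swap-factors (toℚ (f t)) (λ′ x) (value x t)))
                                  (sym (∑ℚ.*-distribˡ-sum (λ′ x) (λ t → toℚ (f t) ℚ.* value x t)))) ⟩
  ∑ℚ.sum (λ x → λ′ x ℚ.* ∑ℚ.sum (λ t → toℚ (f t) ℚ.* value x t))
    ≡⟨ ∑ℚ.sum-cong-≗ (λ x → cong (λ′ x ℚ.*_) (sym (functional x))) ⟩
  ∑ℚ.sum (λ x → λ′ x ℚ.* toℚ (sumℤ (λ t → f t ℤ.* pt P x (u t))))
    ≤⟨ ∑ℚ-mono-≤ (λ x → ℚₚ.*-monoˡ-≤-nonNeg (λ′ x) {{ℚ.nonNegative (λ′≥0 x)}} (toℚ-mono-≤ (valid x))) ⟩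
  ∑ℚ.sum (λ x → λ′ x ℚ.* toℚ β)
    ≡⟨ ∑ℚ.*-distribʳ-sum (toℚ β) λ′ ⟨
  ∑ℚ.sum λ′ ℚ.* toℚ β
    ≡⟨ cong (ℚ._* toℚ β) (trans (sym (sumℚ≡∑ λ′)) λ′-sum) ⟩
  1ℚ ℚ.* toℚ β
    ≡⟨ ℚₚ.*-identityˡ (toℚ β) ⟩
  toℚ β ∎)
  where
  open ℚₚ.≤-Reasoning
  value : Fin (size P) → Fin n → ℚ
  value x t = toℚ (pt P x (u t))
  combination : ∀ i → toℚ (z i) ≡ ∑ℚ.sum (λ x → λ′ x ℚ.* toℚ (pt P x i))
  combination i = trans (sym (λ′-combination i)) (sumℚ≡∑ (λ x → λ′ x ℚ.* toℚ (pt P x i)))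
  functional : ∀ x → toℚ (sumℤ (λ t → f t ℤ.* pt P x (u t))) ≡ ∑ℚ.sum (λ t → toℚ (f t) ℚ.* value x t)
  functional x = trans (toℚ-sumℤ (λ t → f t ℤ.* pt P x (u t))) (∑ℚ.sum-cong-≗ (λ t → toℚ-* (f t) (pt P x (u t))))
  swap-factors : ∀ a l c → a ℚ.* (l ℚ.* c) ≡ l ℚ.* (a ℚ.* c)
  swap-factors a l c = trans (sym (ℚₚ.*-assoc a l c)) (trans (cong (ℚ._* c) (ℚₚ.*-comm a l)) (ℚₚ.*-assoc l a c))

-- Signed boxes

data Part (X : Set) : Set where
  ⟨_⟩  : X → Part X
  full : Part X

_∈ₚ_ : ∀ {X} → X → Part X → Set
x ∈ₚ ⟨ y ⟩ = y ≡ x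
x ∈ₚ full  = ⊤

module PartDecidable {X : Set} (_≟_ : DecidableEquality X) where

  _∈ₚ?_ : ∀ x P → Dec (x ∈ₚ P)
  x ∈ₚ? ⟨ y ⟩ = y ≟ x
  x ∈ₚ? full  = yes tt

  _≟ₚ_ : DecidableEquality (Part X)
  ⟨ x ⟩ ≟ₚ ⟨ y ⟩ = map′ (cong ⟨_⟩) (λ { refl → refl }) (x ≟ y)
  ⟨ x ⟩ ≟ₚ full  = no λ ()
  full  ≟ₚ ⟨ y ⟩ = no λ ()
  full  ≟ₚ full  = yes refl

  hull : X → X → Part X
  hull x y with x ≟ y
  ... | yes _ = ⟨ x ⟩
  ... | no  _ = full

  ∈-hull-of-≡ : ∀ {x y w} → w ≡ x → w ∈ₚ hull x y
  ∈-hull-of-≡ {x} {y} w≡x with x ≟ y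
  ... | yes _ = sym w≡x
  ... | no  _ = tt

  ∈-hull-of-≢ : ∀ {x y} w → x ≢ y → w ∈ₚ hull x y
  ∈-hull-of-≢ {x} {y} w x≢y with x ≟ y
  ... | yes x≡y = ⊥-elim (x≢y x≡y)
  ... | no  _   = tt

  hull-least : ∀ {x y w} P → x ∈ₚ P → y ∈ₚ P → w ∈ₚ hull x y → w ∈ₚ P
  hull-least {x} {y} P x∈P y∈P w∈hull with x ≟ y
  hull-least ⟨ p ⟩ x∈P y∈P w∈hull | yes _   = trans x∈P w∈hull
  hull-least full  x∈P y∈P w∈hull | yes _   = tt
  hull-least ⟨ p ⟩ x∈P y∈P w∈hull | no  x≢y = ⊥-elim (x≢y (trans (sym x∈P) y∈P))
  hull-least full  x∈P y∈P w∈hull | no  _   = tt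

𝟙 : Bool → ℕ
𝟙 true  = 1
𝟙 false = 0

sgn : Sign → ℤ
sgn s = s ◃ 1

sgn-isUnit : ∀ s → IsUnit (sgn s)
sgn-isUnit Sign.+ = inj₁ refl
sgn-isUnit Sign.- = inj₂ refl

decide-≤ : ∀ {a b} → True (a ℤ.≤? b) → a ℤ.≤ b
decide-≤ = toWitness

does⇒proof : ∀ {A : Set} (a? : Dec A) → does a? ≡ true → A
does⇒proof (yes a) _ = a

Bounded : ℤ → ℤ → Set
Bounded β v = v ℤ.≤ β × - v ℤ.≤ β

bounded : ∀ {β v} → True (v ℤ.≤? β) → True (- v ℤ.≤? β) → Bounded β v
bounded v≤β -v≤β = decide-≤ v≤β , decide-≤ -v≤β

indicators : ∀ {n} → (Fin n → ℤ) → (Fin n → Bool) → ℤ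
indicators f τ = sumℤ (λ t → f t * + 𝟙 (τ t))

single-bounded : ∀ t → Bounded 1ℤ (indicators (1ℤ ∷ []) (t ∷ []))
single-bounded true  = bounded _ _
single-bounded false = bounded _ _

difference-bounded : ∀ t₁ t₂ → Bounded 1ℤ (indicators (1ℤ ∷ -1ℤ ∷ []) (t₁ ∷ t₂ ∷ []))
difference-bounded true  true  = bounded _ _
difference-bounded true  false = bounded _ _
difference-bounded false true  = bounded _ _
difference-bounded false false = bounded _ _

exclusive-bounded : ∀ t₁ t₂ → (t₁ ≡ true → t₂ ≡ true → ⊥) →
                    Bounded 1ℤ (indicators (1ℤ ∷ 1ℤ ∷ []) (t₁ ∷ t₂ ∷ []))
exclusive-bounded true  true  both = ⊥-elim (both refl refl)
exclusive-bounded true  false _    = bounded _ _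
exclusive-bounded false true  _    = bounded _ _
exclusive-bounded false false _    = bounded _ _

closure-bounded : ∀ t₁ t₂ t₃ t₄ → (t₁ ≡ true → t₂ ≡ true → t₃ ≡ true → t₄ ≡ true) →
                  Bounded (+ 2) (indicators (1ℤ ∷ 1ℤ ∷ 1ℤ ∷ -1ℤ ∷ []) (t₁ ∷ t₂ ∷ t₃ ∷ t₄ ∷ []))
closure-bounded true  true  true  true  _ = bounded _ _
closure-bounded true  true  true  false c with c refl refl refl
... | ()
closure-bounded true  true  false true  _ = bounded _ _
closure-bounded true  true  false false _ = bounded _ _
closure-bounded true  false true  true  _ = bounded _ _
closure-bounded true  false true  false _ = bounded _ _
closure-bounded true  false false true  _ = bounded _ _
closure-bounded true  false false false _ = bounded _ _
closure-bounded false true  true  true  _ = bounded _ _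
closure-bounded false true  true  false _ = bounded _ _
closure-bounded false true  false true  _ = bounded _ _
closure-bounded false true  false false _ = bounded _ _
closure-bounded false false true  true  _ = bounded _ _
closure-bounded false false true  false _ = bounded _ _
closure-bounded false false false true  _ = bounded _ _
closure-bounded false false false false _ = bounded _ _

sign-factor : ∀ {n} (f : Fin n → ℤ) s (τ : Fin n → Bool) →
              sumℤ (λ t → f t * (s ◃ 𝟙 (τ t))) ≡ sgn s * indicators f τ
sign-factor f s τ = trans (sumℤ-cong term) (sumℤ-*ˡ (sgn s) (λ t → f t * + 𝟙 (τ t)))
  where
  signed-indicator : ∀ s t → s ◃ 𝟙 t ≡ sgn s * + 𝟙 t
  signed-indicator Sign.+ true  = refl
  signed-indicator Sign.+ false = refl
  signed-indicator Sign.- true  = refl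
  signed-indicator Sign.- false = refl
  commute : ∀ a σ v → a * (σ * v) ≡ σ * (a * v)
  commute = solve-∀
  term : ∀ t → f t * (s ◃ 𝟙 (τ t)) ≡ sgn s * (f t * + 𝟙 (τ t))
  term t = trans (cong (f t *_) (signed-indicator s (τ t))) (commute (f t) (sgn s) (+ 𝟙 (τ t)))

Bounded⇒signed : ∀ {β v} s → Bounded β v → sgn s * v ℤ.≤ β
Bounded⇒signed {β} {v} Sign.+ (v≤β , _)   = subst (ℤ._≤ β) (sym (ℤₚ.*-identityˡ v)) v≤β
Bounded⇒signed {β} {v} Sign.- (_ , -v≤β)  = subst (ℤ._≤ β) (sym (ℤₚ.-1*i≡-i v)) -v≤β

successor-not-below : ∀ {n} → ¬ (+ suc n ℤ.≤ + n)
successor-not-below (ℤ.+≤+ 1+n≤n) = ℕₚ.1+n≰n 1+n≤n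

trit-of-bounds : ∀ {v} → 1ℤ * v + 0ℤ ℤ.≤ 1ℤ → 1ℤ * - v + 0ℤ ℤ.≤ 1ℤ → v ≡ 0ℤ ⊎ IsUnit v
trit-of-bounds {+ 0}             _                  _                  = inj₁ refl
trit-of-bounds {+ 1}             _                  _                  = inj₂ (inj₁ refl)
trit-of-bounds {+ suc (suc n)}   (ℤ.+≤+ (ℕ.s≤s ())) _
trit-of-bounds { ℤ.-[1+ 0 ]}     _                  _                  = inj₂ (inj₂ refl)
trit-of-bounds { ℤ.-[1+ suc n ]} _                  (ℤ.+≤+ (ℕ.s≤s ()))

difference-forces : ∀ {a v} → a ≡ 1ℤ → v ≡ -1ℤ → ¬ (1ℤ * a + (-1ℤ * v + 0ℤ) ℤ.≤ 1ℤ)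
difference-forces refl refl = successor-not-below

exclusion-forces : ∀ {a v} → a ≡ 1ℤ → v ≡ 1ℤ → ¬ (1ℤ * a + (1ℤ * v + 0ℤ) ℤ.≤ 1ℤ)
exclusion-forces refl refl = successor-not-below

closure-forces : ∀ {a b c v} → a ≡ 1ℤ → b ≡ 1ℤ → c ≡ 1ℤ → v ≡ 0ℤ →
                 ¬ (1ℤ * a + (1ℤ * b + (1ℤ * c + (-1ℤ * v + 0ℤ))) ℤ.≤ + 2)
closure-forces refl refl refl refl = successor-not-below

module SignedBoxes {B R C : Set}
  (_≟ᴮ_ : DecidableEquality B) (_≟ᴿ_ : DecidableEquality R) (_≟ᶜ_ : DecidableEquality C) where

  module ℛ = PartDecidable _≟ᴿ_
  module 𝒞 = PartDecidable _≟ᶜ_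

  Cell : Set
  Cell = B × R × C

  _≟ᶜᵉˡˡ_ : DecidableEquality Cell
  _≟ᶜᵉˡˡ_ = ≡-dec _≟ᴮ_ (≡-dec _≟ᴿ_ _≟ᶜ_)

  record Box : Set where
    constructor box
    field
      block : B
      rows  : Part R
      cols  : Part C

  _≟ᵇᵒˣ_ : DecidableEquality Box
  box β P Q ≟ᵇᵒˣ box β′ P′ Q′ =
    map′ (λ { (refl , refl , refl) → refl }) (λ { refl → refl , refl , refl })
         ((β ≟ᴮ β′) ×-dec (P ℛ.≟ₚ P′) ×-dec (Q 𝒞.≟ₚ Q′))

  _∈_ : Cell → Box → Set
  (β′ , r , c) ∈ box β P Q = β ≡ β′ × r ∈ₚ P × c ∈ₚ Q

  _∈?_ : ∀ x b → Dec (x ∈ b)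
  (β′ , r , c) ∈? box β P Q = (β ≟ᴮ β′) ×-dec (r ℛ.∈ₚ? P) ×-dec (c 𝒞.∈ₚ? Q)

  data Point : Set where
    origin : Point
    _·_    : Sign → Box → Point

  ⟦_⟧ : Point → Cell → ℤ
  ⟦ origin ⟧ x = 0ℤ
  ⟦ s · b ⟧  x = s ◃ 𝟙 (does (x ∈? b))

  ⟦⟧-∈ : ∀ s b x → x ∈ b → ⟦ s · b ⟧ x ≡ sgn s
  ⟦⟧-∈ s b x x∈b = cong (λ t → s ◃ 𝟙 t) (dec-true (x ∈? b) x∈b)

  ⟦⟧-∉ : ∀ s b x → ¬ x ∈ b → ⟦ s · b ⟧ x ≡ 0ℤ
  ⟦⟧-∉ s b x x∉b = cong (λ t → s ◃ 𝟙 t) (dec-false (x ∈? b) x∉b)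

  ⟦⟧-nonzero⇒∈ : ∀ s b x → ⟦ s · b ⟧ x ≢ 0ℤ → x ∈ b
  ⟦⟧-nonzero⇒∈ s b x nz = decidable-stable (x ∈? b) (nz ∘ ⟦⟧-∉ s b x)

  ⟦⟧-nonzero⇒unit : ∀ y x → ⟦ y ⟧ x ≢ 0ℤ → IsUnit (⟦ y ⟧ x)
  ⟦⟧-nonzero⇒unit origin  x nz = ⊥-elim (nz refl)
  ⟦⟧-nonzero⇒unit (s · b) x nz = subst IsUnit (sym (⟦⟧-∈ s b x (⟦⟧-nonzero⇒∈ s b x nz))) (sgn-isUnit s)

  ⟦⟧-resign : ∀ s t b x → ⟦ t · b ⟧ x ≡ (sgn t * sgn s) * ⟦ s · b ⟧ x
  ⟦⟧-resign s t b x with x ∈? b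
  ... | no  x∉b = begin
    ⟦ t · b ⟧ x                  ≡⟨ ⟦⟧-∉ t b x x∉b ⟩
    0ℤ                           ≡⟨ ℤₚ.*-zeroʳ (sgn t * sgn s) ⟨
    (sgn t * sgn s) * 0ℤ         ≡⟨ cong (sgn t * sgn s *_) (⟦⟧-∉ s b x x∉b) ⟨
    (sgn t * sgn s) * ⟦ s · b ⟧ x ∎
    where open ≡-Reasoning
  ... | yes x∈b = begin
    ⟦ t · b ⟧ x                  ≡⟨ ⟦⟧-∈ t b x x∈b ⟩
    sgn t                        ≡⟨ flip-sign s t ⟩
    (sgn t * sgn s) * sgn s      ≡⟨ cong (sgn t * sgn s *_) (⟦⟧-∈ s b x x∈b) ⟨
    (sgn t * sgn s) * ⟦ s · b ⟧ x ∎
    where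
    open ≡-Reasoning
    flip-sign : ∀ s t → sgn t ≡ (sgn t * sgn s) * sgn s
    flip-sign Sign.+ Sign.+ = refl
    flip-sign Sign.+ Sign.- = refl
    flip-sign Sign.- Sign.+ = refl
    flip-sign Sign.- Sign.- = refl

  Thin : Point → Set
  Thin origin                  = ⊤
  Thin (s · box β ⟨ r ⟩ ⟨ c ⟩) = ⊤
  Thin (s · box β ⟨ r ⟩ full)  = ⊥
  Thin (s · box β full Q)      = ⊥

  thin? : ∀ y → Dec (Thin y)
  thin? origin                  = yes tt
  thin? (s · box β ⟨ r ⟩ ⟨ c ⟩) = yes tt
  thin? (s · box β ⟨ r ⟩ full)  = no λ ()
  thin? (s · box β full Q)      = no λ ()

  thin-support : ∀ y → Thin y → ∀ x x′ → ⟦ y ⟧ x ≢ 0ℤ → ⟦ y ⟧ x′ ≢ 0ℤ → x ≡ x′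
  thin-support origin                  _ x x′ nz nz′ = ⊥-elim (nz refl)
  thin-support (s · box β ⟨ r ⟩ ⟨ c ⟩) _ x x′ nz nz′ =
    trans (the-cell x (⟦⟧-nonzero⇒∈ s _ x nz)) (sym (the-cell x′ (⟦⟧-nonzero⇒∈ s _ x′ nz′)))
    where
    the-cell : ∀ x → x ∈ box β ⟨ r ⟩ ⟨ c ⟩ → x ≡ (β , r , c)
    the-cell _ (refl , refl , refl) = refl

  signedBox : ∀ y → ¬ Thin y → ∃₂ λ s b → y ≡ s · b
  signedBox origin  wide = ⊥-elim (wide tt)
  signedBox (s · b) _    = s , b , refl

  rowBox blockBox colBox : Cell → Box
  rowBox   (β , r , c) = box β ⟨ r ⟩ full
  blockBox (β , r , c) = box β full full
  colBox   (β , r , c) = box β full ⟨ c ⟩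

  ∈-rowBox : ∀ x → x ∈ rowBox x
  ∈-rowBox x = refl , refl , tt

  WideShape : Box → Cell → Set
  WideShape b x = b ≡ rowBox x ⊎ b ≡ blockBox x ⊎ b ≡ colBox x

  wide-box-shape : ∀ s b x → ¬ Thin (s · b) → x ∈ b → WideShape b x
  wide-box-shape s (box β ⟨ r ⟩ ⟨ c ⟩) x wide _                = ⊥-elim (wide tt)
  wide-box-shape s (box β ⟨ r ⟩ full)  x wide (refl , refl , _) = inj₁ refl
  wide-box-shape s (box β full full)   x wide (refl , _ , _)    = inj₂ (inj₁ refl)
  wide-box-shape s (box β full ⟨ c ⟩)  x wide (refl , _ , refl) = inj₂ (inj₂ refl)

  side : Box → Bool
  side (box _ _ full)  = true
  side (box _ _ ⟨ _ ⟩) = false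

  data IsRowOf : Box → Box → Set where
    row-of : ∀ {β r} → IsRowOf (box β ⟨ r ⟩ full) (box β full full)

  isRowOf? : ∀ b′ b → Dec (IsRowOf b′ b)
  isRowOf? (box β′ ⟨ r ⟩ full)  (box β full full)   = map′ (λ { refl → row-of }) (λ { row-of → refl }) (β′ ≟ᴮ β)
  isRowOf? (box _ ⟨ _ ⟩ ⟨ _ ⟩)  _                   = no λ ()
  isRowOf? (box _ full _)       _                   = no λ ()
  isRowOf? (box _ ⟨ _ ⟩ full)   (box _ ⟨ _ ⟩ _)     = no λ ()
  isRowOf? (box _ ⟨ _ ⟩ full)   (box _ full ⟨ _ ⟩)  = no λ ()

  IsRowOf-⊆ : ∀ {b′ b} x → IsRowOf b′ b → x ∈ b′ → x ∈ b
  IsRowOf-⊆ x row-of (β≡ , _ , _) = β≡ , tt , tt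

  IsRowOf-rowBox : ∀ {b′ b} x → IsRowOf b′ b → x ∈ b′ → b′ ≡ rowBox x
  IsRowOf-rowBox x row-of (refl , refl , _) = refl

  rowBox-IsRowOf : ∀ x → IsRowOf (rowBox x) (blockBox x)
  rowBox-IsRowOf x = row-of

  IsRowOf-not-chained : ∀ {b″ b′ b} → IsRowOf b′ b → ¬ IsRowOf b″ b′
  IsRowOf-not-chained row-of ()

  pointMatrix : ∀ {k} → (Fin k → Cell) → (Fin k → Point) → Matrix k
  pointMatrix ℓ p i j = ⟦ p j ⟧ (ℓ i)

  collision? : ∀ {n} {X : Set} → DecidableEquality X → (f : Fin n → X) → Dec (∃₂ λ i i′ → i ≢ i′ × f i ≡ f i′)
  collision? _≟ˣ_ f = any? λ i → any? λ i′ → ¬? (i ≟ i′) ×-dec (f i ≟ˣ f i′)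

  no-collision⇒injective : ∀ {n} {X : Set} {f : Fin n → X} → ¬ (∃₂ λ i i′ → i ≢ i′ × f i ≡ f i′) →
                           ∀ i i′ → f i ≡ f i′ → i ≡ i′
  no-collision⇒injective none i i′ eq = decidable-stable (i ≟ i′) (λ i≢i′ → none (i , i′ , i≢i′ , eq))

  module WideColumns {k} (ℓ : Fin k → Cell) (p : Fin k → Point) (p-wide : ∀ j → ¬ Thin (p j)) where

    s : Fin k → Sign
    s j = proj₁ (signedBox (p j) (p-wide j))

    b : Fin k → Box
    b j = proj₁ (proj₂ (signedBox (p j) (p-wide j)))

    p-signed : ∀ j → p j ≡ s j · b j
    p-signed j = proj₂ (proj₂ (signedBox (p j) (p-wide j)))

    wide : ∀ j → ¬ Thin (s j · b j)
    wide j = subst (λ y → ¬ Thin y) (p-signed j) (p-wide j)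

    M : Matrix k
    M i j = ⟦ s j · b j ⟧ (ℓ i)

    M≗pointMatrix : ∀ i j → M i j ≡ pointMatrix ℓ p i j
    M≗pointMatrix i j = cong (λ y → ⟦ y ⟧ (ℓ i)) (sym (p-signed j))

    repeated-box : ∀ {j j′} → j ≢ j′ → b j ≡ b j′ → det k M ≡ 0ℤ
    repeated-box {j} {j′} j≢j′ same = det-proportional-columns M j≢j′ (sgn (s j′) * sgn (s j)) proportional
      where
      proportional : ∀ i → M i j′ ≡ (sgn (s j′) * sgn (s j)) * M i j
      proportional i = trans (cong (λ β → ⟦ s j′ · β ⟧ (ℓ i)) (sym same)) (⟦⟧-resign (s j) (s j′) (b j) (ℓ i))

    -- A subtracts from each block column the row columns of its block; afterwards a row meets at most
    -- one row-or-block column and at most one column column.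
    module _ (b-injective : ∀ j j′ → b j ≡ b j′ → j ≡ j′) where

      A : Fin k → Fin k → ℤ
      A j l = if does (isRowOf? (b l) (b j)) then - (sgn (s j) * sgn (s l)) else 0ℤ

      A-unrelated : ∀ j l → ¬ IsRowOf (b l) (b j) → A j l ≡ 0ℤ
      A-unrelated j l ¬row = cong (λ t → if t then - (sgn (s j) * sgn (s l)) else 0ℤ)
                                  (dec-false (isRowOf? (b l) (b j)) ¬row)

      Covered : Fin k → Cell → Set
      Covered j x = ∃ λ l → IsRowOf (b l) (b j) × x ∈ b l

      term-covered : ∀ j l x → IsRowOf (b l) (b j) → x ∈ b l → A j l * ⟦ s l · b l ⟧ x ≡ - sgn (s j)
      term-covered j l x row x∈ = begin
        A j l * ⟦ s l · b l ⟧ x                 ≡⟨ cong₂ _*_ (cong (λ t → if t then - (sgn (s j) * sgn (s l)) else 0ℤ)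
                                                                   (dec-true (isRowOf? (b l) (b j)) row))
                                                             (⟦⟧-∈ (s l) (b l) x x∈) ⟩
        - (sgn (s j) * sgn (s l)) * sgn (s l)   ≡⟨ cancel (s j) (s l) ⟩
        - sgn (s j)                             ∎
        where
        open ≡-Reasoning
        cancel : ∀ σ τ → - (sgn σ * sgn τ) * sgn τ ≡ - sgn σ
        cancel Sign.+ Sign.+ = refl
        cancel Sign.+ Sign.- = refl
        cancel Sign.- Sign.+ = refl
        cancel Sign.- Sign.- = refl

      term-uncovered : ∀ j l x → ¬ (IsRowOf (b l) (b j) × x ∈ b l) → A j l * ⟦ s l · b l ⟧ x ≡ 0ℤ
      term-uncovered j l x uncovered with isRowOf? (b l) (b j)
      ... | no _    = refl
      ... | yes row = trans (cong (- (sgn (s j) * sgn (s l)) *_) (⟦⟧-∉ (s l) (b l) x (λ x∈ → uncovered (row , x∈))))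
                            (ℤₚ.*-zeroʳ (- (sgn (s j) * sgn (s l))))

      correction : ∀ j x → (sumℤ (λ l → A j l * ⟦ s l · b l ⟧ x) ≡ - sgn (s j) × Covered j x)
                           ⊎ (sumℤ (λ l → A j l * ⟦ s l · b l ⟧ x) ≡ 0ℤ × ¬ Covered j x)
      correction j x with any? (λ l → isRowOf? (b l) (b j) ×-dec (x ∈? b l))
      ... | yes (l₀ , row₀ , x∈₀) =
        inj₁ (trans (sumℤ-single l₀ (λ l → A j l * ⟦ s l · b l ⟧ x) others) (term-covered j l₀ x row₀ x∈₀) , l₀ , row₀ , x∈₀)
        where
        others : ∀ l → l ≢ l₀ → A j l * ⟦ s l · b l ⟧ x ≡ 0ℤ
        others l l≢l₀ = term-uncovered j l x λ (row , x∈) →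
          l≢l₀ (b-injective l l₀ (trans (IsRowOf-rowBox x row x∈) (sym (IsRowOf-rowBox x row₀ x∈₀))))
      ... | no uncovered = inj₂ (sumℤ-zero (λ l → term-uncovered j l x (λ c → uncovered (l , c))) , uncovered)

      N : Matrix k
      N i j = M i j + sumℤ (λ l → A j l * M i l)

      N-entry : ∀ i j → N i j ≡ 0ℤ ⊎ (N i j ≡ sgn (s j) × ℓ i ∈ b j × ¬ Covered j (ℓ i))
      N-entry i j with correction j (ℓ i)
      ... | inj₁ (Σ≡ , l , row , x∈) =
        inj₁ (trans (cong₂ _+_ (⟦⟧-∈ (s j) (b j) (ℓ i) (IsRowOf-⊆ (ℓ i) row x∈)) Σ≡) (ℤₚ.+-inverseʳ (sgn (s j))))
      ... | inj₂ (Σ≡ , uncovered) with ℓ i ∈? b j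
      ...   | yes x∈ = inj₂ (trans (cong₂ _+_ (⟦⟧-∈ (s j) (b j) (ℓ i) x∈) Σ≡) (ℤₚ.+-identityʳ (sgn (s j))) , x∈ , uncovered)
      ...   | no  x∉ = inj₁ (cong₂ _+_ (⟦⟧-∉ (s j) (b j) (ℓ i) x∉) Σ≡)

      effective : ∀ i j → N i j ≢ 0ℤ → ℓ i ∈ b j × ¬ Covered j (ℓ i)
      effective i j nz with N-entry i j
      ... | inj₁ N≡0                 = ⊥-elim (nz N≡0)
      ... | inj₂ (_ , x∈ , uncovered) = x∈ , uncovered

      one-per-side : ∀ i j j′ → N i j ≢ 0ℤ → N i j′ ≢ 0ℤ → side (b j) ≡ side (b j′) → j ≡ j′
      one-per-side i j j′ nz nz′ same-side with effective i j nz | effective i j′ nz′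
      ... | x∈ , free | x∈′ , free′ = by-shape (wide-box-shape (s j) (b j) x (wide j) x∈)
                                                (wide-box-shape (s j′) (b j′) x (wide j′) x∈′)
        where
        x : Cell
        x = ℓ i
        covers : ∀ {l m} → b l ≡ rowBox x → b m ≡ blockBox x → Covered m x
        covers {l} e e′ = l , subst₂ IsRowOf (sym e) (sym e′) (rowBox-IsRowOf x) , subst (x ∈_) (sym e) (∈-rowBox x)
        side-clash : ∀ {c c′} → b j ≡ c → b j′ ≡ c′ → side c ≢ side c′ → j ≡ j′
        side-clash e e′ differ = ⊥-elim (differ (trans (sym (cong side e)) (trans same-side (cong side e′))))
        by-shape : WideShape (b j) x → WideShape (b j′) x → j ≡ j′
        by-shape (inj₁ e)        (inj₁ e′)        = b-injective j j′ (trans e (sym e′))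
        by-shape (inj₂ (inj₁ e)) (inj₂ (inj₁ e′)) = b-injective j j′ (trans e (sym e′))
        by-shape (inj₂ (inj₂ e)) (inj₂ (inj₂ e′)) = b-injective j j′ (trans e (sym e′))
        by-shape (inj₁ e)        (inj₂ (inj₁ e′)) = ⊥-elim (free′ (covers e e′))
        by-shape (inj₂ (inj₁ e)) (inj₁ e′)        = ⊥-elim (free (covers e′ e))
        by-shape (inj₁ e)        (inj₂ (inj₂ e′)) = side-clash e e′ λ ()
        by-shape (inj₂ (inj₁ e)) (inj₂ (inj₂ e′)) = side-clash e e′ λ ()
        by-shape (inj₂ (inj₂ e)) (inj₁ e′)        = side-clash e e′ λ ()
        by-shape (inj₂ (inj₂ e)) (inj₂ (inj₁ e′)) = side-clash e e′ λ ()

      N-bipartite : BipartiteRows N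
      N-bipartite = record
        { columnSign      = sgn ∘ s
        ; side            = side ∘ b
        ; columnSign-unit = sgn-isUnit ∘ s
        ; entry           = λ i j → Sum.map₂ proj₁ (N-entry i j)
        ; one-per-side    = one-per-side
        }

      only-fixed : ∀ j l → A j l ≡ 0ℤ ⊎ (∀ m → A l m ≡ 0ℤ)
      only-fixed j l with isRowOf? (b l) (b j)
      ... | yes row = inj₂ (λ m → A-unrelated l m (IsRowOf-not-chained row))
      ... | no _    = inj₁ refl

      M-ZeroOrUnit : ZeroOrUnit (det k M)
      M-ZeroOrUnit = subst ZeroOrUnit (det-add-combinations M A only-fixed) (BipartiteRows⇒ZeroOrUnit N-bipartite)

    wide-ZeroOrUnit : ZeroOrUnit (det k (pointMatrix ℓ p))
    wide-ZeroOrUnit = subst ZeroOrUnit (det-cong M≗pointMatrix) M-wide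
      where
      M-wide : ZeroOrUnit (det k M)
      M-wide with collision? _≟ᵇᵒˣ_ b
      ... | yes (j , j′ , j≢j′ , same) = inj₁ (repeated-box j≢j′ same)
      ... | no distinct                = M-ZeroOrUnit (no-collision⇒injective distinct)

  pointMatrix-ZeroOrUnit : ∀ {k} (ℓ : Fin k → Cell) (p : Fin k → Point) → ZeroOrUnit (det k (pointMatrix ℓ p))
  pointMatrix-ZeroOrUnit {zero}  ℓ p = inj₂ (inj₁ refl)
  pointMatrix-ZeroOrUnit {suc k} ℓ p with collision? _≟ᶜᵉˡˡ_ ℓ
  ... | yes (i , i′ , i≢i′ , ℓi≡ℓi′) = inj₁ (det-equal-rows (pointMatrix ℓ p) i≢i′ (λ j → cong ⟦ p j ⟧ ℓi≡ℓi′))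
  ... | no distinct-cells with any? (thin? ∘ p)
  ...   | no ¬thin       = WideColumns.wide-ZeroOrUnit ℓ p (λ j thin → ¬thin (j , thin))
  ...   | yes (j , thin) = ZeroOrUnit-det-sparse-column (pointMatrix ℓ p) j sparse unit
                             (λ i → pointMatrix-ZeroOrUnit (ℓ ∘ punchIn i) (p ∘ punchIn j))
    where
    sparse : ∀ i i′ → ⟦ p j ⟧ (ℓ i) ≢ 0ℤ → ⟦ p j ⟧ (ℓ i′) ≢ 0ℤ → i ≡ i′
    sparse i i′ nz nz′ = no-collision⇒injective distinct-cells i i′ (thin-support (p j) thin (ℓ i) (ℓ i′) nz nz′)
    unit : ∀ i → ⟦ p j ⟧ (ℓ i) ≢ 0ℤ → IsUnit (⟦ p j ⟧ (ℓ i))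
    unit i = ⟦⟧-nonzero⇒unit (p j) (ℓ i)

  blockOf : Cell → B
  blockOf = proj₁

  rowOf : Cell → R
  rowOf = proj₁ ∘ proj₂

  colOf : Cell → C
  colOf = proj₂ ∘ proj₂

  hull-box-least : ∀ b x y w v → x ∈ b → y ∈ b → w ∈ b →
                   v ∈ box (blockOf x) (ℛ.hull (rowOf x) (rowOf y)) (𝒞.hull (colOf x) (colOf w)) → v ∈ b
  hull-box-least (box β P Q) x y w v (β≡ , x∈P , x∈Q) (_ , y∈P , _) (_ , _ , w∈Q) (β≡′ , v∈P , v∈Q) =
    trans β≡ β≡′ , ℛ.hull-least P x∈P y∈P v∈P , 𝒞.hull-least Q x∈Q w∈Q v∈Q

  negate : Point → Point
  negate origin  = origin
  negate (s · b) = Sign.opposite s · b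

  ⟦negate⟧ : ∀ y x → ⟦ negate y ⟧ x ≡ - ⟦ y ⟧ x
  ⟦negate⟧ origin  x = refl
  ⟦negate⟧ (s · b) x = opposite-indicator s (does (x ∈? b))
    where
    opposite-indicator : ∀ s t → Sign.opposite s ◃ 𝟙 t ≡ - (s ◃ 𝟙 t)
    opposite-indicator Sign.+ true  = refl
    opposite-indicator Sign.+ false = refl
    opposite-indicator Sign.- true  = refl
    opposite-indicator Sign.- false = refl

  -- Membership in the convex hull of all points, through the integral inequalities valid on them.
  record SatisfiesValidInequalities {d} (ℓ : Fin d → Cell) (z : Fin d → ℤ) : Set where
    constructor satisfies
    field
      apply : ∀ {n} (f : Fin n → ℤ) (u : Fin n → Fin d) β →
              (∀ y → sumℤ (λ t → f t * ⟦ y ⟧ (ℓ (u t))) ℤ.≤ β) → sumℤ (λ t → f t * z (u t)) ℤ.≤ β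
  open SatisfiesValidInequalities

  valid-on-points : ∀ {n} (f : Fin n → ℤ) (x : Fin n → Cell) β → 0ℤ ℤ.≤ β →
                    (∀ b → Bounded β (indicators f (λ t → does (x t ∈? b)))) →
                    ∀ y → sumℤ (λ t → f t * ⟦ y ⟧ (x t)) ℤ.≤ β
  valid-on-points f x β 0≤β _       origin  = subst (ℤ._≤ β) (sym (sumℤ-zero (λ t → ℤₚ.*-zeroʳ (f t)))) 0≤β
  valid-on-points f x β _   bounded (s · b) =
    subst (ℤ._≤ β) (sym (sign-factor f s (λ t → does (x t ∈? b)))) (Bounded⇒signed s (bounded b))

  SatisfiesValidInequalities-neg : ∀ {d} {ℓ : Fin d → Cell} {z} →
    SatisfiesValidInequalities ℓ z → SatisfiesValidInequalities ℓ (λ u → - z u)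
  SatisfiesValidInequalities-neg {ℓ = ℓ} {z} z-valid = satisfies λ f u β valid →
    subst (ℤ._≤ β) (sumℤ-cong (λ t → move-sign (f t) (z (u t))))
      (apply z-valid (λ t → - f t) u β λ y → subst (ℤ._≤ β) (sumℤ-cong (negated f u y)) (valid (negate y)))
    where
    move-sign : ∀ a v → - a * v ≡ a * - v
    move-sign = solve-∀
    negated : ∀ {n} (f : Fin n → ℤ) u y t → f t * ⟦ negate y ⟧ (ℓ (u t)) ≡ - f t * ⟦ y ⟧ (ℓ (u t))
    negated f u y t = trans (cong (f t *_) (⟦negate⟧ y (ℓ (u t)))) (sym (move-sign (f t) (⟦ y ⟧ (ℓ (u t)))))

  valid-trit : ∀ {d} {ℓ : Fin d → Cell} {z} → SatisfiesValidInequalities ℓ z → ∀ u → z u ≡ 0ℤ ⊎ IsUnit (z u)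
  valid-trit {ℓ = ℓ} {z} z-valid u = trit-of-bounds (upper z-valid) (upper (SatisfiesValidInequalities-neg z-valid))
    where
    upper : ∀ {w} → SatisfiesValidInequalities ℓ w → 1ℤ * w u + 0ℤ ℤ.≤ 1ℤ
    upper w-valid = apply w-valid (1ℤ ∷ []) (u ∷ []) 1ℤ
      (valid-on-points (1ℤ ∷ []) (ℓ u ∷ []) 1ℤ (decide-≤ _) (λ b → single-bounded (does (ℓ u ∈? b))))

  module Support {d} (ℓ : Fin d → Cell) {z : Fin d → ℤ} (z-valid : SatisfiesValidInequalities ℓ z)
                 (i : Fin d) (z-i : z i ≡ 1ℤ) where

    z-01 : ∀ u → z u ≡ 0ℤ ⊎ z u ≡ 1ℤ
    z-01 u with valid-trit z-valid u
    ... | inj₁ z-u        = inj₁ z-u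
    ... | inj₂ (inj₁ z-u) = inj₂ z-u
    ... | inj₂ (inj₂ z-u) = ⊥-elim (difference-forces z-i z-u (apply z-valid (1ℤ ∷ -1ℤ ∷ []) (i ∷ u ∷ []) 1ℤ
           (valid-on-points (1ℤ ∷ -1ℤ ∷ []) (ℓ i ∷ ℓ u ∷ []) 1ℤ (decide-≤ _)
             (λ b → difference-bounded (does (ℓ i ∈? b)) (does (ℓ u ∈? b))))))

    z-block : ∀ u → z u ≡ 1ℤ → blockOf (ℓ u) ≡ blockOf (ℓ i)
    z-block u z-u = decidable-stable (blockOf (ℓ u) ≟ᴮ blockOf (ℓ i)) λ blocks≢ →
      exclusion-forces z-i z-u (apply z-valid (1ℤ ∷ 1ℤ ∷ []) (i ∷ u ∷ []) 1ℤ
        (valid-on-points (1ℤ ∷ 1ℤ ∷ []) (ℓ i ∷ ℓ u ∷ []) 1ℤ (decide-≤ _)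
          (λ b → exclusive-bounded (does (ℓ i ∈? b)) (does (ℓ u ∈? b)) λ i∈ u∈ →
             blocks≢ (trans (sym (proj₁ (does⇒proof (ℓ u ∈? b) u∈))) (proj₁ (does⇒proof (ℓ i ∈? b) i∈))))))

    z-closed : ∀ m a u → (∀ b → ℓ i ∈ b → ℓ m ∈ b → ℓ a ∈ b → ℓ u ∈ b) →
               z m ≡ 1ℤ → z a ≡ 1ℤ → z u ≡ 1ℤ
    z-closed m a u closed z-m z-a with z-01 u
    ... | inj₂ z-u = z-u
    ... | inj₁ z-u = ⊥-elim (closure-forces z-i z-m z-a z-u
          (apply z-valid (1ℤ ∷ 1ℤ ∷ 1ℤ ∷ -1ℤ ∷ []) (i ∷ m ∷ a ∷ u ∷ []) (+ 2)
            (valid-on-points (1ℤ ∷ 1ℤ ∷ 1ℤ ∷ -1ℤ ∷ []) (ℓ i ∷ ℓ m ∷ ℓ a ∷ ℓ u ∷ []) (+ 2) (decide-≤ _)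
              (λ b → closure-bounded (does (ℓ i ∈? b)) (does (ℓ m ∈? b)) (does (ℓ a ∈? b)) (does (ℓ u ∈? b))
                λ i∈ m∈ a∈ → dec-true (ℓ u ∈? b)
                  (closed b (does⇒proof (ℓ i ∈? b) i∈) (does⇒proof (ℓ m ∈? b) m∈) (does⇒proof (ℓ a ∈? b) a∈))))))

    module Spread {X : Set} (_≟ˣ_ : DecidableEquality X) (coordinate : Cell → X) where
      open PartDecidable _≟ˣ_

      spread? : Dec (∃ λ m → z m ≡ 1ℤ × coordinate (ℓ m) ≢ coordinate (ℓ i))
      spread? = any? (λ m → (z m ℤ.≟ 1ℤ) ×-dec ¬? (coordinate (ℓ m) ≟ˣ coordinate (ℓ i)))

      witness : Fin d
      witness with spread?
      ... | yes (m , _) = m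
      ... | no  _       = i

      z-witness : z witness ≡ 1ℤ
      z-witness with spread?
      ... | yes (_ , z-m , _) = z-m
      ... | no  _             = z-i

      support-covered : ∀ u → z u ≡ 1ℤ → coordinate (ℓ u) ∈ₚ hull (coordinate (ℓ i)) (coordinate (ℓ witness))
      support-covered u z-u with spread?
      ... | yes (_ , _ , m≢i) = ∈-hull-of-≢ (coordinate (ℓ u)) (m≢i ∘ sym)
      ... | no  no-spread     = ∈-hull-of-≡
              (decidable-stable (coordinate (ℓ u) ≟ˣ coordinate (ℓ i)) (λ u≢i → no-spread (u , z-u , u≢i)))

    module Rows = Spread _≟ᴿ_ rowOf
    module Cols = Spread _≟ᶜ_ colOf

    -- The least box containing ℓ i, a support cell off its row and a support cell off its column
    -- (ℓ i itself when there is none).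
    hullBox : Box
    hullBox = box (blockOf (ℓ i)) (ℛ.hull (rowOf (ℓ i)) (rowOf (ℓ Rows.witness)))
                                  (𝒞.hull (colOf (ℓ i)) (colOf (ℓ Cols.witness)))

    support⊆hullBox : ∀ u → z u ≡ 1ℤ → ℓ u ∈ hullBox
    support⊆hullBox u z-u = sym (z-block u z-u) , Rows.support-covered u z-u , Cols.support-covered u z-u

    hullBox⊆support : ∀ u → ℓ u ∈ hullBox → z u ≡ 1ℤ
    hullBox⊆support u u∈ = z-closed Rows.witness Cols.witness u
      (λ b i∈ m∈ a∈ → hull-box-least b (ℓ i) (ℓ Rows.witness) (ℓ Cols.witness) (ℓ u) i∈ m∈ a∈ u∈)
      Rows.z-witness Cols.z-witness

    z≡hullBox : ∀ u → z u ≡ ⟦ Sign.+ · hullBox ⟧ (ℓ u)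
    z≡hullBox u with ℓ u ∈? hullBox
    ... | yes u∈ = trans (hullBox⊆support u u∈) (sym (⟦⟧-∈ Sign.+ hullBox (ℓ u) u∈))
    ... | no  u∉ with z-01 u
    ...   | inj₁ z-u = trans z-u (sym (⟦⟧-∉ Sign.+ hullBox (ℓ u) u∉))
    ...   | inj₂ z-u = ⊥-elim (u∉ (support⊆hullBox u z-u))

  classify : ∀ {d} (ℓ : Fin d → Cell) {z} → SatisfiesValidInequalities ℓ z → ∃ λ y → ∀ u → z u ≡ ⟦ y ⟧ (ℓ u)
  classify ℓ {z} z-valid with any? (λ u → ¬? (z u ℤ.≟ 0ℤ))
  ... | no all-zero = origin , λ u → decidable-stable (z u ℤ.≟ 0ℤ) (λ nz → all-zero (u , nz))
  ... | yes (i , nz) with valid-trit z-valid i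
  ...   | inj₁ z-i        = ⊥-elim (nz z-i)
  ...   | inj₂ (inj₁ z-i) = Sign.+ · Support.hullBox ℓ z-valid i z-i , Support.z≡hullBox ℓ z-valid i z-i
  ...   | inj₂ (inj₂ z-i) = negate (Sign.+ · hullBox) , z≡
    where
    open Support ℓ (SatisfiesValidInequalities-neg z-valid) i (cong -_ z-i) using (hullBox; z≡hullBox)
    z≡ : ∀ u → z u ≡ ⟦ negate (Sign.+ · hullBox) ⟧ (ℓ u)
    z≡ u = begin
      z u                            ≡⟨ ℤₚ.neg-involutive (z u) ⟨
      - - z u                        ≡⟨ cong -_ (z≡hullBox u) ⟩
      - ⟦ Sign.+ · hullBox ⟧ (ℓ u)   ≡⟨ ⟦negate⟧ (Sign.+ · hullBox) (ℓ u) ⟨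
      ⟦ negate (Sign.+ · hullBox) ⟧ (ℓ u) ∎
      where open ≡-Reasoning

  boxConfiguration-TU : (P : PointConfig) (ℓ : Fin (dim P) → Cell) (desc : Fin (size P) → Point) →
                        (∀ x i → pt P x i ≡ ⟦ desc x ⟧ (ℓ i)) → TotallyUnimodular P
  boxConfiguration-TU P ℓ desc pt≡ k r c c-lattice =
    subst ZeroOrUnit (det-cong (λ i j → sym (proj₂ (classified j) (r i))))
          (pointMatrix-ZeroOrUnit (ℓ ∘ r) (proj₁ ∘ classified))
    where
    valid : ∀ j → SatisfiesValidInequalities ℓ (c j)
    valid j = satisfies λ f u β on-points → IsLatticePoint⇒valid P (c j) (c-lattice j) f u β
      (λ x → subst (ℤ._≤ β) (sumℤ-cong (λ t → cong (f t *_) (sym (pt≡ x (u t))))) (on-points (desc x)))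
    classified : ∀ j → ∃ λ y → ∀ u → c j u ≡ ⟦ y ⟧ (ℓ u)
    classified j = classify ℓ (valid j)

-- Cyclotomic polytopes

_×-≟_ : ∀ {A B : Set} → DecidableEquality A → DecidableEquality B → DecidableEquality (A × B)
(_≟₁_ ×-≟ _≟₂_) (a , b) (a′ , b′) =
  map′ (λ (e₁ , e₂) → cong₂ _,_ e₁ e₂) (λ e → cong proj₁ e , cong proj₂ e) ((a ≟₁ a′) ×-dec (b ≟₂ b′))

SignedPart : Set → Set
SignedPart B = Sign × B × Part ℕ

partValue : ∀ {B : Set} → DecidableEquality B → SignedPart B → B × ℕ → ℤ
partValue _≟ᴮ_ (s , β , P) (β′ , r) = s ◃ 𝟙 (does (β ≟ᴮ β′) ∧ does (r ℕᵖ.∈ₚ? P))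
  where module ℕᵖ = PartDecidable ℕ._≟_

𝟙-∧ : ∀ x y → 𝟙 (x ∧ y) ≡ 𝟙 x ℕ.* 𝟙 y
𝟙-∧ true  true  = refl
𝟙-∧ true  false = refl
𝟙-∧ false y     = refl

◃𝟙-* : ∀ s t x y → (s ◃ 𝟙 x) * (t ◃ 𝟙 y) ≡ (s Sign.* t) ◃ 𝟙 (x ∧ y)
◃𝟙-* s t x y = trans (sym (ℤₚ.◃-distrib-* s t (𝟙 x) (𝟙 y))) (cong ((s Sign.* t) ◃_) (sym (𝟙-∧ x y)))

module Embedding {B : Set} (_≟ᴮ_ : DecidableEquality B) where
  open SignedBoxes _≟ᴮ_ ℕ._≟_ ⊤ₚ._≟_ public

  embed : SignedPart B → Point
  embed (s , β , P) = s · box β P full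

  embedLabel : B × ℕ → Cell
  embedLabel (β , r) = β , r , tt

  partValue-embed : ∀ v l → partValue _≟ᴮ_ v l ≡ ⟦ embed v ⟧ (embedLabel l)
  partValue-embed (s , β , P) (β′ , r) =
    cong (λ t → s ◃ 𝟙 (does (β ≟ᴮ β′) ∧ t)) (sym (Boolₚ.∧-identityʳ _))

module Tensor {B₁ B₂ : Set} (_≟₁_ : DecidableEquality B₁) (_≟₂_ : DecidableEquality B₂) where
  open SignedBoxes (_≟₁_ ×-≟ _≟₂_) ℕ._≟_ ℕ._≟_
  open CommutativeSemigroupProperties (CommutativeMonoid.commutativeSemigroup Boolₚ.∧-commutativeMonoid)
    using (interchange)

  _⊗ᵖ_ : SignedPart B₁ → SignedPart B₂ → Point
  (s₁ , β₁ , P₁) ⊗ᵖ (s₂ , β₂ , P₂) = (s₁ Sign.* s₂) · box (β₁ , β₂) P₁ P₂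

  _⊗ˡ_ : B₁ × ℕ → B₂ × ℕ → Cell
  (β₁ , r₁) ⊗ˡ (β₂ , r₂) = (β₁ , β₂) , r₁ , r₂

  partValue-⊗ : ∀ v₁ l₁ v₂ l₂ →
                partValue _≟₁_ v₁ l₁ * partValue _≟₂_ v₂ l₂ ≡ ⟦ v₁ ⊗ᵖ v₂ ⟧ (l₁ ⊗ˡ l₂)
  partValue-⊗ (s₁ , β₁ , P₁) (β₁′ , r₁) (s₂ , β₂ , P₂) (β₂′ , r₂) =
    trans (◃𝟙-* s₁ s₂ (b₁ ∧ p₁) (b₂ ∧ p₂))
          (cong (λ t → (s₁ Sign.* s₂) ◃ 𝟙 t) (interchange b₁ p₁ b₂ p₂))
    where
    b₁ p₁ b₂ p₂ : Bool
    b₁ = does (β₁ ≟₁ β₁′)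
    p₁ = does (r₁ ℛ.∈ₚ? P₁)
    b₂ = does (β₂ ≟₂ β₂′)
    p₂ = does (r₂ ℛ.∈ₚ? P₂)

module Extension {B₀ B R C : Set} (_≟₀_ : DecidableEquality B₀)
  (_≟ᴮ_ : DecidableEquality B) (_≟ᴿ_ : DecidableEquality R) (_≟ᶜ_ : DecidableEquality C) where
  module Base     = SignedBoxes _≟ᴮ_ _≟ᴿ_ _≟ᶜ_
  module Extended = SignedBoxes (_≟₀_ ×-≟ _≟ᴮ_) _≟ᴿ_ _≟ᶜ_
  module ℕᵖ = PartDecidable ℕ._≟_

  extend : SignedPart B₀ → Base.Point → Extended.Point
  extend _             Base.origin                    = Extended.origin
  extend (s₀ , k , _) (s Base.· Base.box β P Q) = (s₀ Sign.* s) Extended.· Extended.box (k , β) P Q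

  extendLabel : B₀ × ℕ → Base.Cell → Extended.Cell
  extendLabel (k , _) (β , r , c) = (k , β) , r , c

  partValue-extend : ∀ v l y x → proj₂ l ∈ₚ proj₂ (proj₂ v) →
                     partValue _≟₀_ v l * Base.⟦ y ⟧ x ≡ Extended.⟦ extend v y ⟧ (extendLabel l x)
  partValue-extend v l Base.origin x _ = ℤₚ.*-zeroʳ (partValue _≟₀_ v l)
  partValue-extend (s₀ , k , P₀) (k′ , r₀) (s Base.· Base.box β P Q) (β′ , r , c) r₀∈P₀ =
    trans (◃𝟙-* s₀ s (b₀ ∧ does (r₀ ℕᵖ.∈ₚ? P₀)) (bβ ∧ pq))
          (cong (λ t → (s₀ Sign.* s) ◃ 𝟙 t)
                (trans (cong (λ t → (b₀ ∧ t) ∧ (bβ ∧ pq)) (dec-true (r₀ ℕᵖ.∈ₚ? P₀) r₀∈P₀))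
                (trans (cong (_∧ (bβ ∧ pq)) (Boolₚ.∧-identityʳ b₀)) (sym (Boolₚ.∧-assoc b₀ bβ pq)))))
    where
    b₀ bβ pq : Bool
    b₀ = does (k ≟₀ k′)
    bβ = does (β ≟ᴮ β′)
    pq = does (r Base.ℛ.∈ₚ? P) ∧ does (c Base.𝒞.∈ₚ? Q)

-- Coordinate k(p−1) + j′ of C_{p^α} is the cell (k, j′); the vertex ζ^(j p^a + k) is +e_(k,j) for
-- j < p − 1 and minus the whole block k for j = p − 1.
cycLabel : ∀ p a → Fin (p ℕ.^ a ℕ.* (p ℕ.∸ 1)) → Fin (p ℕ.^ a) × ℕ
cycLabel p a i = proj₁ (remQuot {p ℕ.^ a} (p ℕ.∸ 1) i) , toℕ (proj₂ (remQuot {p ℕ.^ a} (p ℕ.∸ 1) i))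

vertexSign : ∀ {p} → Fin p → Sign
vertexSign {p} j with toℕ j ℕ.≟ (p ℕ.∸ 1)
... | yes _ = Sign.-
... | no  _ = Sign.+

vertexPart : ∀ {p} → Fin p → Part ℕ
vertexPart {p} j with toℕ j ℕ.≟ (p ℕ.∸ 1)
... | yes _ = full
... | no  _ = ⟨ toℕ j ⟩

cycVertex : ∀ p a → Fin (p ℕ.^ ℕ.suc a) → SignedPart (Fin (p ℕ.^ a))
cycVertex p a n = vertexSign j , k , vertexPart j
  where
  j : Fin p
  j = proj₁ (remQuot {p} (p ℕ.^ a) n)
  k : Fin (p ℕ.^ a)
  k = proj₂ (remQuot {p} (p ℕ.^ a) n)

cycPt≡partValue : ∀ p a n i → cycPt p a n i ≡ partValue _≟_ (cycVertex p a n) (cycLabel p a i)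
cycPt≡partValue p a n i with Fin.quotRem {p} (p ℕ.^ a) n | Fin.quotRem {p ℕ.^ a} (p ℕ.∸ 1) i
... | k , j | j′ , k′ with k ≟ k′
...   | no  _ = refl
...   | yes _ with toℕ j ℕ.≟ (p ℕ.∸ 1)
...     | yes _ = refl
...     | no  _ with toℕ j ℕ.≟ toℕ j′
...       | yes j≡j′ = cong (λ t → Sign.+ ◃ 𝟙 t) (sym (dec-true (toℕ j ℕ.≟ toℕ j′) j≡j′))
...       | no  j≢j′ = cong (λ t → Sign.+ ◃ 𝟙 t) (sym (dec-false (toℕ j ℕ.≟ toℕ j′) j≢j′))

prime-power-TU : ∀ p a → TotallyUnimodular (Cyc p a)
prime-power-TU p a =
  boxConfiguration-TU (Cyc p a)
    (embedLabel ∘ cycLabel p a) (embed ∘ cycVertex p a)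
    (λ n i → trans (cycPt≡partValue p a n i) (partValue-embed (cycVertex p a n) (cycLabel p a i)))
  where open Embedding _≟_

module CyclotomicPair (p a q b : ℕ) where
  open Tensor (_≟_ {p ℕ.^ a}) (_≟_ {q ℕ.^ b}) public
  open SignedBoxes ((_≟_ {p ℕ.^ a}) ×-≟ (_≟_ {q ℕ.^ b})) ℕ._≟_ ℕ._≟_ public

  label : Fin (dim (Cyc p a ⊗ Cyc q b)) → Cell
  label i = let (i₁ , i₂) = remQuot {dim (Cyc p a)} (dim (Cyc q b)) i in cycLabel p a i₁ ⊗ˡ cycLabel q b i₂

  vertex : Fin (size (Cyc p a ⊗ Cyc q b)) → Point
  vertex x = let (n₁ , n₂) = remQuot {size (Cyc p a)} (size (Cyc q b)) x in cycVertex p a n₁ ⊗ᵖ cycVertex q b n₂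

  pt≡vertex : ∀ x i → pt (Cyc p a ⊗ Cyc q b) x i ≡ ⟦ vertex x ⟧ (label i)
  pt≡vertex x i = trans (cong₂ _*_ (cycPt≡partValue p a n₁ i₁) (cycPt≡partValue q b n₂ i₂))
                        (partValue-⊗ (cycVertex p a n₁) (cycLabel p a i₁) (cycVertex q b n₂) (cycLabel q b i₂))
    where
    n₁ : Fin (size (Cyc p a))
    n₁ = proj₁ (remQuot {size (Cyc p a)} (size (Cyc q b)) x)
    n₂ : Fin (size (Cyc q b))
    n₂ = proj₂ (remQuot {size (Cyc p a)} (size (Cyc q b)) x)
    i₁ : Fin (dim (Cyc p a))
    i₁ = proj₁ (remQuot {dim (Cyc p a)} (dim (Cyc q b)) i)
    i₂ : Fin (dim (Cyc q b))
    i₂ = proj₂ (remQuot {dim (Cyc p a)} (dim (Cyc q b)) i)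

two-prime-powers-TU : ∀ p q a b → TotallyUnimodular (Cyc p a ⊗ Cyc q b)
two-prime-powers-TU p q a b =
  boxConfiguration-TU (Cyc p a ⊗ Cyc q b) label vertex pt≡vertex
  where open CyclotomicPair p a q b

vertexPart-two : ∀ (j : Fin 2) (j′ : Fin 1) → toℕ j′ ∈ₚ vertexPart j
vertexPart-two zero       zero = refl
vertexPart-two (suc zero) zero = tt

two-and-two-odd-prime-powers-TU : ∀ p q a b c → TotallyUnimodular (Cyc 2 a ⊗ (Cyc p b ⊗ Cyc q c))
two-and-two-odd-prime-powers-TU p q a b c =
  Extended.boxConfiguration-TU (Cyc 2 a ⊗ (Cyc p b ⊗ Cyc q c)) label vertex pt≡
  where
  open Extension (_≟_ {2 ℕ.^ a}) ((_≟_ {p ℕ.^ b}) ×-≟ (_≟_ {q ℕ.^ c})) ℕ._≟_ ℕ._≟_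
  module Pair = CyclotomicPair p b q c
  label : Fin (dim (Cyc 2 a ⊗ (Cyc p b ⊗ Cyc q c))) → Extended.Cell
  label i = let (i₀ , i′) = remQuot {dim (Cyc 2 a)} (dim (Cyc p b ⊗ Cyc q c)) i in
            extendLabel (cycLabel 2 a i₀) (Pair.label i′)
  vertex : Fin (size (Cyc 2 a ⊗ (Cyc p b ⊗ Cyc q c))) → Extended.Point
  vertex x = let (n₀ , x′) = remQuot {size (Cyc 2 a)} (size (Cyc p b ⊗ Cyc q c)) x in
             extend (cycVertex 2 a n₀) (Pair.vertex x′)
  pt≡ : ∀ x i → pt (Cyc 2 a ⊗ (Cyc p b ⊗ Cyc q c)) x i ≡ Extended.⟦ vertex x ⟧ (label i)
  pt≡ x i = trans (cong₂ _*_ (cycPt≡partValue 2 a n₀ i₀) (Pair.pt≡vertex x′ i′))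
                  (partValue-extend (cycVertex 2 a n₀) (cycLabel 2 a i₀) (Pair.vertex x′) (Pair.label i′)
                     (vertexPart-two (proj₁ (remQuot {2} (2 ℕ.^ a) n₀)) (proj₂ (remQuot {2 ℕ.^ a} 1 i₀))))
    where
    n₀ : Fin (size (Cyc 2 a))
    n₀ = proj₁ (remQuot {size (Cyc 2 a)} (size (Cyc p b ⊗ Cyc q c)) x)
    x′ : Fin (size (Cyc p b ⊗ Cyc q c))
    x′ = proj₂ (remQuot {size (Cyc 2 a)} (size (Cyc p b ⊗ Cyc q c)) x)
    i₀ : Fin (dim (Cyc 2 a))
    i₀ = proj₁ (remQuot {dim (Cyc 2 a)} (dim (Cyc p b ⊗ Cyc q c)) i)
    i′ : Fin (dim (Cyc p b ⊗ Cyc q c))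
    i′ = proj₂ (remQuot {dim (Cyc 2 a)} (dim (Cyc p b ⊗ Cyc q c)) i)

-- The vertex descriptions hold for every p, so the primality hypotheses are not needed.
theorem3p5 :
    (∀ (p a : ℕ) → Prime p → TotallyUnimodular (Cyc p a))
    × (∀ (p q a b : ℕ) → Prime p → Prime q → p ≢ q →
        TotallyUnimodular (Cyc p a ⊗ Cyc q b))
    × (∀ (p q a b c : ℕ) → Prime p → Prime q → p ≢ q → p ≢ 2 → q ≢ 2 →
        TotallyUnimodular (Cyc 2 a ⊗ (Cyc p b ⊗ Cyc q c)))
theorem3p5 =
    (λ p a _ → prime-power-TU p a)
  , (λ p q a b _ _ _ → two-prime-powers-TU p q a b)
  , (λ p q a b c _ _ _ _ _ → two-and-two-odd-prime-powers-TU p q a b c)
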